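{- Let $p$ be a prime, $s>0$ an integer, and $H_s$ a normal subgroup of $\mathrm{SL}_2(\mathbb{Z}/p^s\mathbb{Z})$. If $H_s\ne\mathrm{SL}_2(\mathbb{Z}/p^s\mathbb{Z})$, then $p$ divides the index $[\mathrm{SL}_2(\mathbb{Z}/p^s\mathbb{Z}):H_s]$. -}

module Defs where

open import Data.Bool using (Bool; true; false; _∧_; T)
open import Data.Nat using (ℕ; zero; suc; _+_; _*_; _∸_; _<ᵇ_; _≡ᵇ_)
import Data.Nat as N
open import Data.List using (List; []; _∷_; concatMap; map; length; filterᵇ; upTo)
open import Data.Product using (Σ; _×_; _,_)
open import Relation.Binary.PropositionalEquality using (_≡_)

-- Arithmetic of ℤ/nℤ on canonical representatives {0,…,n-1} ⊂ ℕ.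
-- (reduction by 0 is the identity; only used with n = p^s ≥ 2.)
_mod′_ : ℕ → ℕ → ℕ
x mod′ zero    = x
x mod′ (suc k) = x N.% suc k

-- 2×2 matrices over ℤ/nℤ, entries [[a , b] , [c , d]] as representatives < n
record Mat : Set where
  constructor mat
  field
    a b c d : ℕ
open Mat public

module _ (n : ℕ) where

  addₙ : ℕ → ℕ → ℕ
  addₙ x y = (x + y) mod′ n

  mulₙ : ℕ → ℕ → ℕ
  mulₙ x y = (x * y) mod′ n

  negₙ : ℕ → ℕ
  negₙ x = (n ∸ x) mod′ n

  isMatᵇ : Mat → Bool
  isMatᵇ (mat x y z w) = (x <ᵇ n) ∧ (y <ᵇ n) ∧ (z <ᵇ n) ∧ (w <ᵇ n)

  -- determinant ad - bc ≡ 1 in ℤ/nℤ, i.e. ad ≡ bc + 1 (mod n)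
  detOneᵇ : Mat → Bool
  detOneᵇ (mat x y z w) = ((x * w) mod′ n) ≡ᵇ ((y * z + 1) mod′ n)

  inSLᵇ : Mat → Bool
  inSLᵇ m = isMatᵇ m ∧ detOneᵇ m

  InSL : Mat → Set
  InSL m = T (inSLᵇ m)

  matMul : Mat → Mat → Mat
  matMul (mat x y z w) (mat x′ y′ z′ w′) =
    mat (addₙ (mulₙ x x′) (mulₙ y z′)) (addₙ (mulₙ x y′) (mulₙ y w′))
        (addₙ (mulₙ z x′) (mulₙ w z′)) (addₙ (mulₙ z y′) (mulₙ w w′))

  matOne : Mat
  matOne = mat (1 mod′ n) 0 0 (1 mod′ n)

  -- inverse of a determinant-one matrix: the adjugate
  matInv : Mat → Mat
  matInv (mat x y z w) = mat w (negₙ y) (negₙ z) x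

  allMats : List Mat
  allMats =
    concatMap (λ x → concatMap (λ y → concatMap (λ z →
      map (λ w → mat x y z w) (upTo n)) (upTo n)) (upTo n)) (upTo n)

  SLElems : List Mat
  SLElems = filterᵇ inSLᵇ allMats

  Subset : Set
  Subset = Mat → Bool

  record IsNormalSubgroup (H : Subset) : Set where
    field
      ⊆SL      : ∀ m → T (H m) → InSL m
      one∈     : T (H matOne)
      mul∈     : ∀ x y → T (H x) → T (H y) → T (H (matMul x y))
      inv∈     : ∀ x → T (H x) → T (H (matInv x))
      normal   : ∀ g h → InSL g → T (H h) → T (H (matMul (matMul g h) (matInv g)))

  orderSL : ℕ
  orderSL = length SLElems

  order : Subset → ℕ
  order H = length (filterᵇ H SLElems)

-- division returning 0 on division by 0 (never happens for subgroups: |H| ≥ 1)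
_div′_ : ℕ → ℕ → ℕ
x div′ zero    = 0
x div′ (suc k) = x N./ suc k

index : (n : ℕ) → Subset n → ℕ
index n H = orderSL n div′ order n H

Proper : (n : ℕ) → Subset n → Set
Proper n H = Σ Mat λ g → InSL n g × (H g ≡ false)

-- Over ℤ/p^sℤ every g = [[a,b],[c,d]] in SL₂ is a product of elementary matrices
-- [[1,t],[0,1]] and [[1,0],[t,1]]: if c is a unit, g = [[1,x],[0,1]]·[[1,0],[c,1]]·[[1,y],[0,1]]
-- with x = (a-1)c⁻¹ and y = (d-1)c⁻¹; otherwise p ∣ c, so p ∤ a and [[1,0],[1,1]]·g has the
-- unit c + a in that corner.  Hence a proper subgroup H misses an elementary matrix u, and since
-- u^(p^s) = 1, some g = u^(p^j) has g ∉ H but g^p ∈ H.  As p is prime, gⁱ ∉ H for 0 < i < p, so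
-- the translates g⁻ⁱH (0 ≤ i < p) are pairwise disjoint; by normality their union is a subgroup,
-- of order p·|H|.  Lagrange's theorem then gives p·|H| ∣ |SL₂(ℤ/p^sℤ)|.

module Submission where

open import Defs
open import Data.Nat using (ℕ; _^_; _>_)
open import Data.Nat.Divisibility using (_∣_)
open import Data.Nat.Primality using (Prime)

open import Data.Bool using (Bool; true; false; T; _∧_; _∨_; not)
open import Data.Bool.Properties using (T-∧; T-∨)
open import Data.Empty using (⊥; ⊥-elim)
open import Data.Integer using (ℤ; +_; -[1+_]; 0ℤ; 1ℤ)
import Data.Integer as ℤ
import Data.Integer.Properties as ℤ
import Data.Integer.Divisibility.Signed as ℤ∣
open import Data.Integer.Tactic.RingSolver using (solve-∀)
open import Data.List using (List; []; _∷_; _++_; length; filterᵇ; foldr; map; concatMap; upTo)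
open import Data.List.Properties using (length-++; filter-all; filter-none; filter-some)
open import Data.List.Membership.Propositional using (_∈_; lose; find)
open import Data.List.Membership.Propositional.Properties
  using (∈-∃++; ∈-++⁻; ∈-++⁺ˡ; ∈-++⁺ʳ; ∈-filter⁺; ∈-filter⁻; ∈-concatMap⁺; ∈-concatMap⁻; ∈-map⁺; ∈-upTo⁺)
open import Data.List.Relation.Unary.All as All using (All; []; _∷_)
import Data.List.Relation.Unary.All.Properties as All
open import Data.List.Relation.Unary.Any using (here; there)
open import Data.List.Relation.Unary.Unique.Propositional using (Unique; []; _∷_)
import Data.List.Relation.Unary.Unique.Propositional.Properties as Unique
open import Data.Nat as ℕ using (zero; suc; _≤_; _<_; z≤n; s≤s; z<s; NonZero)
import Data.Nat.Properties as ℕ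
open import Data.Nat.Coprimality using (Coprime; coprime-Bézout; coprime-divisor; prime⇒coprime)
import Data.Nat.Coprimality as Coprime
import Data.Nat.Divisibility as ℕ∣
open import Data.Nat.DivMod
  using (m≡m%n+[m/n]*n; [m+kn]%n≡m%n; m<n⇒m%n≡m; m%n<n; m*n%n≡0; n%n≡0; m*n/n≡m)
open import Data.Nat.GCD using (module Bézout)
open import Data.Nat.Induction using (<-wellFounded)
open import Data.Nat.Primality using (prime⇒irreducible; prime⇒nonZero; prime⇒nonTrivial)
open import Data.Product using (Σ; _×_; _,_; proj₁; proj₂; uncurry)
open import Data.Sum using (_⊎_; inj₁; inj₂)
open import Data.Unit using (tt)
open import Function.Base using (_∘_; id)
open import Function.Bundles using (Equivalence)
open import Induction.WellFounded using (Acc; acc)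
open import Relation.Binary.Bundles using (Setoid)
import Relation.Binary.Reasoning.Setoid as SetoidReasoning
open import Relation.Binary.PropositionalEquality
open import Relation.Nullary using (¬_; yes; no)
open import Relation.Nullary.Decidable using (T?)

open Equivalence using (to; from)

injection-length-≤ : ∀ {A B : Set} (f : A → B) {xs : List A} {ys : List B} → Unique xs →
  (∀ {x y} → x ∈ xs → y ∈ xs → f x ≡ f y → x ≡ y) →
  (∀ {x} → x ∈ xs → f x ∈ ys) → length xs ≤ length ys
injection-length-≤ f {[]} _ _ _ = z≤n
injection-length-≤ f {x ∷ xs} {ys} (x∉xs ∷ xs-unique) injective maps-to
  with ys₁ , ys₂ , refl ← ∈-∃++ (maps-to (here refl)) = begin
    suc (length xs)                   ≤⟨ s≤s (injection-length-≤ f xs-unique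
                                           (λ p q → injective (there p) (there q)) maps-to′) ⟩
    suc (length (ys₁ ++ ys₂))         ≡⟨ cong suc (length-++ ys₁) ⟩
    suc (length ys₁ ℕ.+ length ys₂)   ≡⟨ ℕ.+-suc (length ys₁) (length ys₂) ⟨
    length ys₁ ℕ.+ length (f x ∷ ys₂) ≡⟨ length-++ ys₁ ⟨
    length (ys₁ ++ f x ∷ ys₂)         ∎
  where
  open ℕ.≤-Reasoning
  x∉ : ∀ {y} → y ∈ xs → y ≢ x
  x∉ y∈ refl = All.lookup x∉xs y∈ refl
  maps-to′ : ∀ {y} → y ∈ xs → f y ∈ ys₁ ++ ys₂
  maps-to′ {y} y∈ with ∈-++⁻ ys₁ (maps-to (there y∈))
  ... | inj₁ p         = ∈-++⁺ˡ p
  ... | inj₂ (here eq) = ⊥-elim (x∉ y∈ (injective (there y∈) (here refl) eq))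
  ... | inj₂ (there p) = ∈-++⁺ʳ ys₁ p

T-not⁺ : ∀ {b} → ¬ T b → T (not b)
T-not⁺ {false} _  = tt
T-not⁺ {true}  ¬b = ¬b tt

T-not⁻ : ∀ {b} → T (not b) → ¬ T b
T-not⁻ {false} _ ()

length-filterᵇ-split : ∀ {A : Set} (P Q : A → Bool) xs → length (filterᵇ P xs) ≡
  length (filterᵇ (λ x → P x ∧ Q x) xs) ℕ.+ length (filterᵇ (λ x → P x ∧ not (Q x)) xs)
length-filterᵇ-split P Q [] = refl
length-filterᵇ-split P Q (x ∷ xs) with P x | Q x
... | true  | true  = cong suc (length-filterᵇ-split P Q xs)
... | true  | false = trans (cong suc (length-filterᵇ-split P Q xs))
                            (sym (ℕ.+-suc (length (filterᵇ (λ x → P x ∧ Q x) xs)) _))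
... | false | _     = length-filterᵇ-split P Q xs

All-concatMap⁺ : ∀ {A B : Set} {P : B → Set} {f : A → List B} →
  (∀ x → All P (f x)) → ∀ xs → All P (concatMap f xs)
All-concatMap⁺ all-f xs = All.concat⁺ (All.map⁺ (All.universal all-f xs))

concatMap-unique : ∀ {A B : Set} (f : A → List B) (tag : B → A) {xs} → Unique xs →
  (∀ x → Unique (f x)) → (∀ x → All (λ y → tag y ≡ x) (f x)) → Unique (concatMap f xs)
concatMap-unique f tag {[]}     _              _  _      = []
concatMap-unique f tag {x ∷ xs} (x∉xs ∷ xs-unique) f-unique tagged =
  Unique.++⁺ (f-unique x) (concatMap-unique f tag xs-unique f-unique tagged) disjoint
  where
  disjoint : ∀ {y} → ¬ (y ∈ f x × y ∈ concatMap f xs)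
  disjoint (y∈fx , y∈rest) with x′ , x′∈xs , y∈fx′ ← find (∈-concatMap⁻ f y∈rest) =
    All.lookup x∉xs x′∈xs (trans (sym (All.lookup (tagged x) y∈fx)) (All.lookup (tagged x′) y∈fx′))

coprime-^ : ∀ {m n} → Coprime m n → ∀ s → Coprime m (n ^ s)
coprime-^ m⊥n zero    (_ , i∣1) = ℕ∣.∣1⇒≡1 i∣1
coprime-^ {m} {n} m⊥n (suc s) {i} (i∣m , i∣n*nˢ) = coprime-^ m⊥n s (i∣m , coprime-divisor i⊥n i∣n*nˢ)
  where
  i⊥n : Coprime i n
  i⊥n (j∣i , j∣n) = m⊥n (ℕ∣.∣-trans j∣i i∣m , j∣n)

prime∤⇒coprime : ∀ {p u} → Prime p → ¬ p ∣ u → Coprime u p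
prime∤⇒coprime p-prime p∤u (i∣u , i∣p) with prime⇒irreducible p-prime i∣p
... | inj₁ i≡1 = i≡1
... | inj₂ refl = ⊥-elim (p∤u i∣u)

p*h∣o⇒p∣o/h : ∀ {p h o} → 0 < h → p ℕ.* h ∣ o → p ∣ o div′ h
p*h∣o⇒p∣o/h {p} {suc h} {o} _ (ℕ∣.divides q o≡q*[p*h]) =
  subst (p ∣_) (sym o/h≡q*p) (ℕ∣.n∣m*n q)
  where
  o/h≡q*p : o div′ suc h ≡ q ℕ.* p
  o/h≡q*p = trans (cong (ℕ._/ suc h) (trans o≡q*[p*h] (sym (ℕ.*-assoc q p (suc h)))))
                  (m*n/n≡m (q ℕ.* p) (suc h))

-- 2 × 2 integer matrices

module IntegerMatrix where

  open import Data.Integer using (_+_; _*_; _-_; -_)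

  record ℤMat : Set where
    constructor ℤmat
    field A B C D : ℤ
  open ℤMat public

  infixl 7 _⊗_
  _⊗_ : ℤMat → ℤMat → ℤMat
  X ⊗ Y = ℤmat (A X * A Y + B X * C Y) (A X * B Y + B X * D Y)
               (C X * A Y + D X * C Y) (C X * B Y + D X * D Y)

  adj : ℤMat → ℤMat
  adj X = ℤmat (D X) (- B X) (- C X) (A X)

  I : ℤMat
  I = ℤmat 1ℤ 0ℤ 0ℤ 1ℤ

  det : ℤMat → ℤ
  det X = A X * D X - B X * C X

  ℤmat-≡ : ∀ {a b c d a′ b′ c′ d′} → a ≡ a′ → b ≡ b′ → c ≡ c′ → d ≡ d′ →
           ℤmat a b c d ≡ ℤmat a′ b′ c′ d′
  ℤmat-≡ refl refl refl refl = refl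

  1x+0y≡x : ∀ x y → 1ℤ * x + 0ℤ * y ≡ x
  1x+0y≡x = solve-∀

  0x+1y≡y : ∀ x y → 0ℤ * x + 1ℤ * y ≡ y
  0x+1y≡y = solve-∀

  x1+y0≡x : ∀ x y → x * 1ℤ + y * 0ℤ ≡ x
  x1+y0≡x = solve-∀

  x0+y1≡y : ∀ x y → x * 0ℤ + y * 1ℤ ≡ y
  x0+y1≡y = solve-∀

  private
    row-assoc : ∀ r₁ r₂ y₁ y₂ y₃ y₄ c₁ c₃ → (r₁ * y₁ + r₂ * y₃) * c₁ + (r₁ * y₂ + r₂ * y₄) * c₃
                                          ≡ r₁ * (y₁ * c₁ + y₂ * c₃) + r₂ * (y₃ * c₁ + y₄ * c₃)
    row-assoc = solve-∀
    ad+b[-c]≡det : ∀ a b c d → a * d + b * - c ≡ a * d - b * c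
    ad+b[-c]≡det = solve-∀
    c[-b]+da≡det : ∀ a b c d → c * - b + d * a ≡ a * d - b * c
    c[-b]+da≡det = solve-∀
    da+[-b]c≡det : ∀ a b c d → d * a + - b * c ≡ a * d - b * c
    da+[-b]c≡det = solve-∀
    [-c]b+ad≡det : ∀ a b c d → - c * b + a * d ≡ a * d - b * c
    [-c]b+ad≡det = solve-∀
    x[-y]+yx≡0 : ∀ x y → x * - y + y * x ≡ 0ℤ
    x[-y]+yx≡0 = solve-∀
    xy+y[-x]≡0 : ∀ x y → x * y + y * - x ≡ 0ℤ
    xy+y[-x]≡0 = solve-∀
    xy+[-y]x≡0 : ∀ x y → x * y + - y * x ≡ 0ℤ
    xy+[-y]x≡0 = solve-∀
    [-x]y+yx≡0 : ∀ x y → - x * y + y * x ≡ 0ℤ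
    [-x]y+yx≡0 = solve-∀
    det-multiplicative : ∀ a b c d a′ b′ c′ d′ →
      (a * a′ + b * c′) * (c * b′ + d * d′) - (a * b′ + b * d′) * (c * a′ + d * c′)
        ≡ (a * d - b * c) * (a′ * d′ - b′ * c′)
    det-multiplicative = solve-∀
    da-[-b][-c]≡ad-bc : ∀ a b c d → d * a - - b * - c ≡ a * d - b * c
    da-[-b][-c]≡ad-bc = solve-∀

  ⊗-assoc : ∀ X Y Z → (X ⊗ Y) ⊗ Z ≡ X ⊗ (Y ⊗ Z)
  ⊗-assoc (ℤmat a b c d) (ℤmat e f g h) (ℤmat i j k l) = ℤmat-≡
    (row-assoc a b e f g h i k) (row-assoc a b e f g h j l)
    (row-assoc c d e f g h i k) (row-assoc c d e f g h j l)

  ⊗-identityˡ : ∀ X → I ⊗ X ≡ X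
  ⊗-identityˡ (ℤmat a b c d) = ℤmat-≡ (1x+0y≡x a c) (1x+0y≡x b d) (0x+1y≡y a c) (0x+1y≡y b d)

  ⊗-identityʳ : ∀ X → X ⊗ I ≡ X
  ⊗-identityʳ (ℤmat a b c d) = ℤmat-≡ (x1+y0≡x a b) (x0+y1≡y a b) (x1+y0≡x c d) (x0+y1≡y c d)

  ⊗-adjʳ : ∀ X → X ⊗ adj X ≡ ℤmat (det X) 0ℤ 0ℤ (det X)
  ⊗-adjʳ (ℤmat a b c d) =
    ℤmat-≡ (ad+b[-c]≡det a b c d) (x[-y]+yx≡0 a b) (xy+y[-x]≡0 c d) (c[-b]+da≡det a b c d)

  adj-⊗ˡ : ∀ X → adj X ⊗ X ≡ ℤmat (det X) 0ℤ 0ℤ (det X)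
  adj-⊗ˡ (ℤmat a b c d) =
    ℤmat-≡ (da+[-b]c≡det a b c d) (xy+[-y]x≡0 d b) ([-x]y+yx≡0 c a) ([-c]b+ad≡det a b c d)

  det-⊗ : ∀ X Y → det (X ⊗ Y) ≡ det X * det Y
  det-⊗ (ℤmat a b c d) (ℤmat a′ b′ c′ d′) = det-multiplicative a b c d a′ b′ c′ d′

  det-adj : ∀ X → det (adj X) ≡ det X
  det-adj (ℤmat a b c d) = da-[-b][-c]≡ad-bc a b c d

open IntegerMatrix

-- Congruence modulo N

module Congruence (N : ℤ) where

  open import Data.Integer using (_+_; _*_; _-_; -_)

  infix 4 _≈_
  record _≈_ (x y : ℤ) : Set where
    constructor mod
    field divides-difference : N ℤ∣.∣ x - y

  private
    -[x-y]≡y-x : ∀ x y → - (x - y) ≡ y - x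
    -[x-y]≡y-x = solve-∀
    x-z≡[x-y]+[y-z] : ∀ x y z → x - z ≡ (x - y) + (y - z)
    x-z≡[x-y]+[y-z] = solve-∀
    sum-difference : ∀ x y u v → (x + u) - (y + v) ≡ (x - y) + (u - v)
    sum-difference = solve-∀
    product-difference : ∀ x y u v → x * u - y * v ≡ (x - y) * u + y * (u - v)
    product-difference = solve-∀
    negation-difference : ∀ x y → - x - - y ≡ - (x - y)
    negation-difference = solve-∀

  ≈-refl : ∀ {x} → x ≈ x
  ≈-refl {x} = mod (ℤ∣.divides 0ℤ (trans (ℤ.+-inverseʳ x) (sym (ℤ.*-zeroˡ N))))

  ≡⇒≈ : ∀ {x y} → x ≡ y → x ≈ y
  ≡⇒≈ refl = ≈-refl

  ≈-sym : ∀ {x y} → x ≈ y → y ≈ x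
  ≈-sym {x} {y} (mod N∣x-y) = mod (subst (N ℤ∣.∣_) (-[x-y]≡y-x x y) (ℤ∣.∣m⇒∣-m N∣x-y))

  ≈-trans : ∀ {x y z} → x ≈ y → y ≈ z → x ≈ z
  ≈-trans {x} {y} {z} (mod N∣x-y) (mod N∣y-z) =
    mod (subst (N ℤ∣.∣_) (sym (x-z≡[x-y]+[y-z] x y z)) (ℤ∣.∣m∣n⇒∣m+n N∣x-y N∣y-z))

  +-cong : ∀ {x y u v} → x ≈ y → u ≈ v → x + u ≈ y + v
  +-cong {x} {y} {u} {v} (mod N∣x-y) (mod N∣u-v) =
    mod (subst (N ℤ∣.∣_) (sym (sum-difference x y u v)) (ℤ∣.∣m∣n⇒∣m+n N∣x-y N∣u-v))

  *-cong : ∀ {x y u v} → x ≈ y → u ≈ v → x * u ≈ y * v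
  *-cong {x} {y} {u} {v} (mod N∣x-y) (mod N∣u-v) = mod (subst (N ℤ∣.∣_) (sym (product-difference x y u v))
    (ℤ∣.∣m∣n⇒∣m+n (ℤ∣.∣m⇒∣m*n u N∣x-y) (ℤ∣.∣n⇒∣m*n y N∣u-v)))

  +-congˡ : ∀ x {u v} → u ≈ v → x + u ≈ x + v
  +-congˡ x = +-cong (≈-refl {x})

  +-congʳ : ∀ x {u v} → u ≈ v → u + x ≈ v + x
  +-congʳ x u≈v = +-cong u≈v (≈-refl {x})

  *-congˡ : ∀ x {u v} → u ≈ v → x * u ≈ x * v
  *-congˡ x = *-cong (≈-refl {x})

  *-congʳ : ∀ x {u v} → u ≈ v → u * x ≈ v * x
  *-congʳ x u≈v = *-cong u≈v (≈-refl {x})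

  -‿cong : ∀ {x y} → x ≈ y → - x ≈ - y
  -‿cong {x} {y} (mod N∣x-y) = mod (subst (N ℤ∣.∣_) (sym (negation-difference x y)) (ℤ∣.∣m⇒∣-m N∣x-y))

  ≈-setoid : Setoid _ _
  ≈-setoid = record { Carrier = ℤ ; _≈_ = _≈_
                    ; isEquivalence = record { refl = ≈-refl ; sym = ≈-sym ; trans = ≈-trans } }

  infix 4 _≋_
  record _≋_ (X Y : ℤMat) : Set where
    constructor ≋mat
    field A≈ : A X ≈ A Y
          B≈ : B X ≈ B Y
          C≈ : C X ≈ C Y
          D≈ : D X ≈ D Y
  open _≋_ public

  ≋-setoid : Setoid _ _
  ≋-setoid = record
    { Carrier = ℤMat ; _≈_ = _≋_
    ; isEquivalence = record
      { refl  = ≋mat ≈-refl ≈-refl ≈-refl ≈-refl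
      ; sym   = λ (≋mat a b c d) → ≋mat (≈-sym a) (≈-sym b) (≈-sym c) (≈-sym d)
      ; trans = λ (≋mat a b c d) (≋mat a′ b′ c′ d′) →
                  ≋mat (≈-trans a a′) (≈-trans b b′) (≈-trans c c′) (≈-trans d d′)
      }
    }

  ≋-refl : ∀ {X} → X ≋ X
  ≋-refl = Setoid.refl ≋-setoid

  ≋-trans : ∀ {X Y Z} → X ≋ Y → Y ≋ Z → X ≋ Z
  ≋-trans = Setoid.trans ≋-setoid

  ⊗-cong : ∀ {X X′ Y Y′} → X ≋ X′ → Y ≋ Y′ → X ⊗ Y ≋ X′ ⊗ Y′
  ⊗-cong (≋mat a b c d) (≋mat a′ b′ c′ d′) =
    ≋mat (+-cong (*-cong a a′) (*-cong b c′)) (+-cong (*-cong a b′) (*-cong b d′))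
         (+-cong (*-cong c a′) (*-cong d c′)) (+-cong (*-cong c b′) (*-cong d d′))

  ⊗-congˡ : ∀ X {Y Y′} → Y ≋ Y′ → X ⊗ Y ≋ X ⊗ Y′
  ⊗-congˡ X Y≋Y′ = ⊗-cong (≋-refl {X}) Y≋Y′

  ⊗-congʳ : ∀ {X X′} Y → X ≋ X′ → X ⊗ Y ≋ X′ ⊗ Y
  ⊗-congʳ Y X≋X′ = ⊗-cong X≋X′ (≋-refl {Y})

  det-cong : ∀ {X Y} → X ≋ Y → det X ≈ det Y
  det-cong (≋mat a b c d) = +-cong (*-cong a d) (-‿cong (*-cong b c))

  det≈1⇒≋I : ∀ X → det X ≈ 1ℤ → ℤmat (det X) 0ℤ 0ℤ (det X) ≋ I
  det≈1⇒≋I _ det≈1 = ≋mat det≈1 ≈-refl ≈-refl det≈1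

  private
    upper-lower-upper-A : ∀ α γ e → 1ℤ * (1ℤ * 1ℤ + 0ℤ * 0ℤ) + (α - 1ℤ) * e * (γ * 1ℤ + 1ℤ * 0ℤ)
                                  ≡ 1ℤ + (α - 1ℤ) * (γ * e)
    upper-lower-upper-A = solve-∀
    upper-lower-upper-B : ∀ α γ δ e →
      1ℤ * (1ℤ * ((δ - 1ℤ) * e) + 0ℤ * 1ℤ) + (α - 1ℤ) * e * (γ * ((δ - 1ℤ) * e) + 1ℤ * 1ℤ)
        ≡ (δ - 1ℤ) * e + (α - 1ℤ) * (δ - 1ℤ) * e * (γ * e) + (α - 1ℤ) * e
    upper-lower-upper-B = solve-∀
    upper-lower-upper-B′ : ∀ α β γ δ e →
      (δ - 1ℤ) * e + (α - 1ℤ) * (δ - 1ℤ) * e * 1ℤ + (α - 1ℤ) * e ≡ (α * δ - β * γ) * e - e + β * (γ * e)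
    upper-lower-upper-B′ = solve-∀
    upper-lower-upper-C : ∀ γ → 0ℤ * (1ℤ * 1ℤ + 0ℤ * 0ℤ) + 1ℤ * (γ * 1ℤ + 1ℤ * 0ℤ) ≡ γ
    upper-lower-upper-C = solve-∀
    upper-lower-upper-D : ∀ γ δ e →
      0ℤ * (1ℤ * ((δ - 1ℤ) * e) + 0ℤ * 1ℤ) + 1ℤ * (γ * ((δ - 1ℤ) * e) + 1ℤ * 1ℤ) ≡ (δ - 1ℤ) * (γ * e) + 1ℤ
    upper-lower-upper-D = solve-∀
    1+[x-1]*1≡x : ∀ x → 1ℤ + (x - 1ℤ) * 1ℤ ≡ x
    1+[x-1]*1≡x = solve-∀
    [x-1]*1+1≡x : ∀ x → (x - 1ℤ) * 1ℤ + 1ℤ ≡ x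
    [x-1]*1+1≡x = solve-∀
    1*e-e+β*1≡β : ∀ β e → 1ℤ * e - e + β * 1ℤ ≡ β
    1*e-e+β*1≡β = solve-∀

  upper-lower-upper-ℤ : ∀ {α β γ δ e} → γ * e ≈ 1ℤ → α * δ - β * γ ≈ 1ℤ →
    ℤmat 1ℤ ((α - 1ℤ) * e) 0ℤ 1ℤ ⊗ (ℤmat 1ℤ 0ℤ γ 1ℤ ⊗ ℤmat 1ℤ ((δ - 1ℤ) * e) 0ℤ 1ℤ) ≋ ℤmat α β γ δ
  upper-lower-upper-ℤ {α} {β} {γ} {δ} {e} γe≈1 det≈1 = ≋mat
    (begin
      1ℤ * (1ℤ * 1ℤ + 0ℤ * 0ℤ) + (α - 1ℤ) * e * (γ * 1ℤ + 1ℤ * 0ℤ) ≡⟨ upper-lower-upper-A α γ e ⟩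
      1ℤ + (α - 1ℤ) * (γ * e)                                        ≈⟨ +-congˡ 1ℤ (*-congˡ (α - 1ℤ) γe≈1) ⟩
      1ℤ + (α - 1ℤ) * 1ℤ                                             ≡⟨ 1+[x-1]*1≡x α ⟩
      α                                                              ∎)
    (begin
      1ℤ * (1ℤ * ((δ - 1ℤ) * e) + 0ℤ * 1ℤ) + (α - 1ℤ) * e * (γ * ((δ - 1ℤ) * e) + 1ℤ * 1ℤ)
        ≡⟨ upper-lower-upper-B α γ δ e ⟩
      (δ - 1ℤ) * e + (α - 1ℤ) * (δ - 1ℤ) * e * (γ * e) + (α - 1ℤ) * e
        ≈⟨ +-congʳ ((α - 1ℤ) * e) (+-congˡ ((δ - 1ℤ) * e) (*-congˡ ((α - 1ℤ) * (δ - 1ℤ) * e) γe≈1)) ⟩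
      (δ - 1ℤ) * e + (α - 1ℤ) * (δ - 1ℤ) * e * 1ℤ + (α - 1ℤ) * e
        ≡⟨ upper-lower-upper-B′ α β γ δ e ⟩
      (α * δ - β * γ) * e - e + β * (γ * e)
        ≈⟨ +-cong (+-congʳ (- e) (*-congʳ e det≈1)) (*-congˡ β γe≈1) ⟩
      1ℤ * e - e + β * 1ℤ
        ≡⟨ 1*e-e+β*1≡β β e ⟩
      β ∎)
    (≡⇒≈ (upper-lower-upper-C γ))
    (begin
      0ℤ * (1ℤ * ((δ - 1ℤ) * e) + 0ℤ * 1ℤ) + 1ℤ * (γ * ((δ - 1ℤ) * e) + 1ℤ * 1ℤ)
        ≡⟨ upper-lower-upper-D γ δ e ⟩
      (δ - 1ℤ) * (γ * e) + 1ℤ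
        ≈⟨ +-congʳ 1ℤ (*-congˡ (δ - 1ℤ) γe≈1) ⟩
      (δ - 1ℤ) * 1ℤ + 1ℤ
        ≡⟨ [x-1]*1+1≡x δ ⟩
      δ ∎)
    where open SetoidReasoning ≈-setoid

-- Finite groups

-- A finite group inside an ambient type: the operations are total on Carrier, the group laws are
-- only required on the elements, and elements lists each element exactly once.
record FiniteGroup : Set₁ where
  infixl 7 _·_
  infix 8 _⁻¹
  field
    Carrier   : Set
    isElement : Carrier → Bool
    elements  : List Carrier
    elements-unique   : Unique elements
    elements-complete : ∀ {x} → T (isElement x) → x ∈ elements
    elements-sound    : ∀ {x} → x ∈ elements → T (isElement x)

  Element : Carrier → Set
  Element x = T (isElement x)

  field
    _·_ : Carrier → Carrier → Carrier
    ε   : Carrier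
    _⁻¹ : Carrier → Carrier
    ·-closed  : ∀ {x y} → Element x → Element y → Element (x · y)
    ε-closed  : Element ε
    ⁻¹-closed : ∀ {x} → Element x → Element (x ⁻¹)
    assoc     : ∀ x y z → (x · y) · z ≡ x · (y · z)
    identityˡ : ∀ {x} → Element x → ε · x ≡ x
    identityʳ : ∀ {x} → Element x → x · ε ≡ x
    inverseˡ  : ∀ {x} → Element x → x ⁻¹ · x ≡ ε
    inverseʳ  : ∀ {x} → Element x → x · x ⁻¹ ≡ ε

module FiniteGroupTheory (G : FiniteGroup) where

  open FiniteGroup G
  open import Data.Nat using (_+_; _*_; _∸_; _%_; _/_)

  Subsetᵇ : Set
  Subsetᵇ = Carrier → Bool

  record IsSubgroup (H : Subsetᵇ) : Set where
    field
      ⊆G  : ∀ {x} → T (H x) → Element x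
      ε∈  : T (H ε)
      ·∈  : ∀ {x y} → T (H x) → T (H y) → T (H (x · y))
      ⁻¹∈ : ∀ {x} → T (H x) → T (H (x ⁻¹))

  record IsNormal (H : Subsetᵇ) : Set where
    field
      isSubgroup : IsSubgroup H
      conj∈      : ∀ {g h} → Element g → T (H h) → T (H ((g · h) · g ⁻¹))
    open IsSubgroup isSubgroup public

  x⁻¹·[x·y]≡y : ∀ {x y} → Element x → Element y → x ⁻¹ · (x · y) ≡ y
  x⁻¹·[x·y]≡y {x} {y} x∈ y∈ = begin
    x ⁻¹ · (x · y)  ≡⟨ assoc (x ⁻¹) x y ⟨
    (x ⁻¹ · x) · y  ≡⟨ cong (_· y) (inverseˡ x∈) ⟩
    ε · y           ≡⟨ identityˡ y∈ ⟩
    y               ∎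
    where open ≡-Reasoning

  x·[x⁻¹·y]≡y : ∀ {x y} → Element x → Element y → x · (x ⁻¹ · y) ≡ y
  x·[x⁻¹·y]≡y {x} {y} x∈ y∈ = begin
    x · (x ⁻¹ · y)  ≡⟨ assoc x (x ⁻¹) y ⟨
    (x · x ⁻¹) · y  ≡⟨ cong (_· y) (inverseʳ x∈) ⟩
    ε · y           ≡⟨ identityˡ y∈ ⟩
    y               ∎
    where open ≡-Reasoning

  [y·x]·x⁻¹≡y : ∀ {x y} → Element x → Element y → (y · x) · x ⁻¹ ≡ y
  [y·x]·x⁻¹≡y {x} {y} x∈ y∈ = begin
    (y · x) · x ⁻¹  ≡⟨ assoc y x (x ⁻¹) ⟩
    y · (x · x ⁻¹)  ≡⟨ cong (y ·_) (inverseʳ x∈) ⟩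
    y · ε           ≡⟨ identityʳ y∈ ⟩
    y               ∎
    where open ≡-Reasoning

  [y·x⁻¹]·x≡y : ∀ {x y} → Element x → Element y → (y · x ⁻¹) · x ≡ y
  [y·x⁻¹]·x≡y {x} {y} x∈ y∈ = begin
    (y · x ⁻¹) · x  ≡⟨ assoc y (x ⁻¹) x ⟩
    y · (x ⁻¹ · x)  ≡⟨ cong (y ·_) (inverseˡ x∈) ⟩
    y · ε           ≡⟨ identityʳ y∈ ⟩
    y               ∎
    where open ≡-Reasoning

  ⁻¹-anti-homo : ∀ {x y} → Element x → Element y → (x · y) ⁻¹ ≡ y ⁻¹ · x ⁻¹
  ⁻¹-anti-homo {x} {y} x∈ y∈ = begin
    z                                ≡⟨ identityʳ (⁻¹-closed xy∈) ⟨
    z · ε                            ≡⟨ cong (z ·_) xy·inverse ⟨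
    z · ((x · y) · (y ⁻¹ · x ⁻¹))    ≡⟨ assoc z (x · y) _ ⟨
    (z · (x · y)) · (y ⁻¹ · x ⁻¹)    ≡⟨ cong (_· (y ⁻¹ · x ⁻¹)) (inverseˡ xy∈) ⟩
    ε · (y ⁻¹ · x ⁻¹)                ≡⟨ identityˡ (·-closed (⁻¹-closed y∈) (⁻¹-closed x∈)) ⟩
    y ⁻¹ · x ⁻¹                      ∎
    where
    open ≡-Reasoning
    z = (x · y) ⁻¹
    xy∈ = ·-closed x∈ y∈
    xy·inverse : (x · y) · (y ⁻¹ · x ⁻¹) ≡ ε
    xy·inverse = trans (assoc x y _)
      (trans (cong (x ·_) (x·[x⁻¹·y]≡y y∈ (⁻¹-closed x∈))) (inverseʳ x∈))

  conjugate-split : ∀ {g x} h → Element g → Element x → g · (h · x) ≡ ((g · h) · g ⁻¹) · (g · x)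
  conjugate-split {g} {x} h g∈ x∈ = begin
    g · (h · x)                  ≡⟨ assoc g h x ⟨
    (g · h) · x                  ≡⟨ cong ((g · h) ·_) (x⁻¹·[x·y]≡y g∈ x∈) ⟨
    (g · h) · (g ⁻¹ · (g · x))   ≡⟨ assoc (g · h) (g ⁻¹) (g · x) ⟨
    ((g · h) · g ⁻¹) · (g · x)   ∎
    where open ≡-Reasoning

  infixr 8 _^ᴳ_
  _^ᴳ_ : Carrier → ℕ → Carrier
  x ^ᴳ zero  = ε
  x ^ᴳ suc i = x · x ^ᴳ i

  ^-closed : ∀ {x} → Element x → ∀ i → Element (x ^ᴳ i)
  ^-closed x∈ zero    = ε-closed
  ^-closed x∈ (suc i) = ·-closed x∈ (^-closed x∈ i)

  ^-+ : ∀ {x} → Element x → ∀ i j → x ^ᴳ (i + j) ≡ x ^ᴳ i · x ^ᴳ j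
  ^-+ x∈ zero    j = sym (identityˡ (^-closed x∈ j))
  ^-+ {x} x∈ (suc i) j = trans (cong (x ·_) (^-+ x∈ i j)) (sym (assoc x (x ^ᴳ i) (x ^ᴳ j)))

  ^-* : ∀ {x} → Element x → ∀ i j → x ^ᴳ (i * j) ≡ (x ^ᴳ j) ^ᴳ i
  ^-* x∈ zero    j = refl
  ^-* {x} x∈ (suc i) j = trans (^-+ x∈ j (i * j)) (cong (x ^ᴳ j ·_) (^-* x∈ i j))

  product : List Carrier → Carrier
  product = foldr _·_ ε

  module _ {H : Subsetᵇ} (H-subgroup : IsSubgroup H) where
    open IsSubgroup H-subgroup

    ^∈ : ∀ {x} → T (H x) → ∀ i → T (H (x ^ᴳ i))
    ^∈ x∈H zero    = ε∈
    ^∈ x∈H (suc i) = ·∈ x∈H (^∈ x∈H i)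

    product-∈ : ∀ {xs} → All (T ∘ H) xs → T (H (product xs))
    product-∈ []           = ε∈
    product-∈ (x∈H ∷ xs∈H) = ·∈ x∈H (product-∈ xs∈H)

    product-∉ : ∀ {xs} → ¬ T (H (product xs)) → Σ Carrier λ x → x ∈ xs × ¬ T (H x)
    product-∉ {xs} ∏∉H with All.all? (T? ∘ H) xs
    ... | yes xs∈H = ⊥-elim (∏∉H (product-∈ xs∈H))
    ... | no  xs⊈H = find (All.¬All⇒Any¬ (T? ∘ H) xs xs⊈H)

  prime-power-escape : ∀ {H : Subsetᵇ} {u} → Element u → ∀ p s → ¬ T (H u) → T (H (u ^ᴳ (p ^ s))) →
    Σ ℕ λ j → ¬ T (H (u ^ᴳ (p ^ j))) × T (H ((u ^ᴳ (p ^ j)) ^ᴳ p))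
  prime-power-escape {H} {u} u∈ p zero u∉H u¹∈H = ⊥-elim (u∉H (subst (T ∘ H) (identityʳ u∈) u¹∈H))
  prime-power-escape {H} {u} u∈ p (suc s) u∉H uᵖˢ⁺¹∈H with H (u ^ᴳ (p ^ s)) in uᵖˢ∈H?
  ... | true  = prime-power-escape {H} u∈ p s u∉H (subst T (sym uᵖˢ∈H?) tt)
  ... | false = s , subst T uᵖˢ∈H? , subst (T ∘ H) (^-* u∈ p (p ^ s)) uᵖˢ⁺¹∈H

  count : Subsetᵇ → ℕ
  count P = length (filterᵇ P elements)

  private
    ∈-filtered⁻ : ∀ {P x} → x ∈ filterᵇ P elements → Element x × T (P x)
    ∈-filtered⁻ {P} x∈ with x∈elements , Px ← ∈-filter⁻ (T? ∘ P) {xs = elements} x∈ =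
      elements-sound x∈elements , Px

    ∈-filtered⁺ : ∀ {P x} → Element x → T (P x) → x ∈ filterᵇ P elements
    ∈-filtered⁺ {P} x∈ Px = ∈-filter⁺ (T? ∘ P) (elements-complete x∈) Px

  count-≤ : ∀ {P Q} (f f⁻ : Carrier → Carrier) →
    (∀ {x} → Element x → T (P x) → Element (f x) × T (Q (f x))) →
    (∀ {x} → Element x → T (P x) → f⁻ (f x) ≡ x) → count P ≤ count Q
  count-≤ {P} {Q} f f⁻ maps-to retraction =
    injection-length-≤ f (Unique.filter⁺ (T? ∘ P) elements-unique) injective
      (λ x∈ → let (x∈G , Px) = ∈-filtered⁻ x∈ in uncurry (∈-filtered⁺ {Q}) (maps-to x∈G Px))
    where
    injective : ∀ {x y} → x ∈ filterᵇ P elements → y ∈ filterᵇ P elements → f x ≡ f y → x ≡ y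
    injective x∈ y∈ fx≡fy = trans (sym (uncurry retraction (∈-filtered⁻ x∈)))
      (trans (cong f⁻ fx≡fy) (uncurry retraction (∈-filtered⁻ y∈)))

  count-≡ : ∀ {P Q} (f f⁻ : Carrier → Carrier) →
    (∀ {x} → Element x → T (P x) → Element (f x) × T (Q (f x))) →
    (∀ {x} → Element x → T (Q x) → Element (f⁻ x) × T (P (f⁻ x))) →
    (∀ {x} → Element x → T (P x) → f⁻ (f x) ≡ x) →
    (∀ {x} → Element x → T (Q x) → f (f⁻ x) ≡ x) → count P ≡ count Q
  count-≡ f f⁻ maps-to maps-from f⁻∘f f∘f⁻ =
    ℕ.≤-antisym (count-≤ f f⁻ maps-to f⁻∘f) (count-≤ f⁻ f maps-from f∘f⁻)

  count-cong : ∀ {P Q} → (∀ {x} → Element x → T (P x) → T (Q x)) →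
    (∀ {x} → Element x → T (Q x) → T (P x)) → count P ≡ count Q
  count-cong P⇒Q Q⇒P =
    count-≡ id id (λ x∈ Px → x∈ , P⇒Q x∈ Px) (λ x∈ Qx → x∈ , Q⇒P x∈ Qx) (λ _ _ → refl) (λ _ _ → refl)

  count-split : ∀ P Q → count P ≡ count (λ x → P x ∧ Q x) + count (λ x → P x ∧ not (Q x))
  count-split P Q = length-filterᵇ-split P Q elements

  count-∨ : ∀ {P Q} → (∀ {x} → Element x → T (P x) → T (Q x) → ⊥) →
    count (λ x → P x ∨ Q x) ≡ count P + count Q
  count-∨ {P} {Q} disjoint = trans (count-split (λ x → P x ∨ Q x) P) (cong₂ _+_
    (count-cong (λ _ → proj₂ ∘ to T-∧) (λ _ Px → from T-∧ (from T-∨ (inj₁ Px) , Px)))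
    (count-cong only-Q (λ x∈ Qx → from T-∧ (from T-∨ (inj₂ Qx) , T-not⁺ (λ Px → disjoint x∈ Px Qx)))))
    where
    only-Q : ∀ {x} → Element x → T ((P x ∨ Q x) ∧ not (P x)) → T (Q x)
    only-Q {x} _ h with P x
    ... | false = proj₁ (to T-∧ h)

  count-pos : ∀ {P x} → Element x → T (P x) → 0 < count P
  count-pos {P} x∈ Px = filter-some (T? ∘ P) (lose (elements-complete x∈) Px)

  count-witness : ∀ P → count P ≡ 0 ⊎ Σ Carrier (λ x → Element x × T (P x))
  count-witness P with filterᵇ P elements in eq
  ... | []    = inj₁ refl
  ... | x ∷ _ = inj₂ (x , ∈-filtered⁻ (subst (x ∈_) (sym eq) (here refl)))

  count-translateˡ : ∀ P {g} → Element g → count (λ y → P (g · y)) ≡ count P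
  count-translateˡ P {g} g∈ = count-≡ (g ·_) (g ⁻¹ ·_)
    (λ y∈ Pgy → ·-closed g∈ y∈ , Pgy)
    (λ y∈ Py → ·-closed (⁻¹-closed g∈) y∈ , subst (T ∘ P) (sym (x·[x⁻¹·y]≡y g∈ y∈)) Py)
    (λ y∈ _ → x⁻¹·[x·y]≡y g∈ y∈)
    (λ y∈ _ → x·[x⁻¹·y]≡y g∈ y∈)

  module Lagrange {K : Subsetᵇ} (K-subgroup : IsSubgroup K) where
    open IsSubgroup K-subgroup

    LeftInvariant : Subsetᵇ → Set
    LeftInvariant R = ∀ {κ y} → T (K κ) → Element y → T (R y) → T (R (κ · y))

    count-right-coset : ∀ {R x} → LeftInvariant R → Element x → T (R x) →
      count (λ y → R y ∧ K (y · x ⁻¹)) ≡ count K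
    count-right-coset {R} {x} R-inv x∈ Rx = count-≡ (_· x ⁻¹) (_· x)
      (λ y∈ h → ·-closed y∈ (⁻¹-closed x∈) , proj₂ (to T-∧ h))
      (λ κ∈ Kκ → ·-closed κ∈ x∈ ,
         from T-∧ (R-inv Kκ x∈ Rx , subst (T ∘ K) (sym ([y·x]·x⁻¹≡y x∈ κ∈)) Kκ))
      (λ y∈ _ → [y·x⁻¹]·x≡y x∈ y∈)
      (λ κ∈ _ → [y·x]·x⁻¹≡y x∈ κ∈)

    count-K∣count : ∀ R → LeftInvariant R → Acc _<_ (count R) → count K ∣ count R
    count-K∣count R R-inv (acc smaller) with count-witness R
    ... | inj₁ count≡0 = subst (count K ∣_) (sym count≡0) (count K ℕ∣.∣0)
    ... | inj₂ (x , x∈ , Rx) = subst (count K ∣_) (sym split)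
      (ℕ∣.∣m∣n⇒∣m+n ℕ∣.∣-refl (count-K∣count R′ R′-inv (smaller R′<R)))
      where
      R′ : Subsetᵇ
      R′ y = R y ∧ not (K (y · x ⁻¹))
      split : count R ≡ count K + count R′
      split = trans (count-split R (λ y → K (y · x ⁻¹))) (cong (_+ count R′) (count-right-coset R-inv x∈ Rx))
      R′<R : count R′ < count R
      R′<R = subst (count R′ <_) (sym split) (ℕ.m<n+m (count R′) (count-pos ε-closed ε∈))
      R′-inv : LeftInvariant R′
      R′-inv {κ} {y} Kκ y∈ R′y with Ry , y∉Kx ← to T-∧ R′y =
        from T-∧ (R-inv Kκ y∈ Ry , T-not⁺ λ Kκyx⁻¹ → T-not⁻ y∉Kx
          (subst (T ∘ K) (x⁻¹·[x·y]≡y (⊆G Kκ) (·-closed y∈ (⁻¹-closed x∈)))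
            (·∈ (⁻¹∈ Kκ) (subst (T ∘ K) (assoc κ y (x ⁻¹)) Kκyx⁻¹))))

    lagrange : count K ∣ length elements
    lagrange = subst (count K ∣_) count-all≡ (count-K∣count (λ _ → true) (λ _ _ _ → tt) (<-wellFounded _))
      where
      count-all≡ : count (λ _ → true) ≡ length elements
      count-all≡ = cong length (filter-all (T? ∘ λ _ → true) (All.universal (λ _ → tt) elements))

  module PrimeExtension {H : Subsetᵇ} (H-normal : IsNormal H) {g : Carrier} (g∈ : Element g)
                        {p : ℕ} (p-prime : Prime p) (g∉H : ¬ T (H g)) (gᵖ∈H : T (H (g ^ᴳ p))) where
    open IsNormal H-normal

    private
      instance
        p≢0 : NonZero p
        p≢0 = prime⇒nonZero p-prime

      gⁱ∈ : ∀ i → Element (g ^ᴳ i)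
      gⁱ∈ = ^-closed g∈

    ^∈-cancel : ∀ i j → T (H (g ^ᴳ (i + j))) → T (H (g ^ᴳ j)) → T (H (g ^ᴳ i))
    ^∈-cancel i j gⁱ⁺ʲ∈H gʲ∈H = subst (T ∘ H) gⁱʲ/gʲ≡gⁱ (·∈ gⁱ⁺ʲ∈H (⁻¹∈ gʲ∈H))
      where
      gⁱʲ/gʲ≡gⁱ : g ^ᴳ (i + j) · (g ^ᴳ j) ⁻¹ ≡ g ^ᴳ i
      gⁱʲ/gʲ≡gⁱ = trans (cong (_· (g ^ᴳ j) ⁻¹) (^-+ g∈ i j)) ([y·x]·x⁻¹≡y (gⁱ∈ j) (gⁱ∈ i))

    ^∈-bézout : ∀ i j x y → T (H (g ^ᴳ i)) → T (H (g ^ᴳ j)) → 1 + y * j ≡ x * i → T (H g)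
    ^∈-bézout i j x y gⁱ∈H gʲ∈H eq = subst (T ∘ H) (identityʳ g∈)
      (^∈-cancel 1 (y * j) (subst (T ∘ H) g^xi≡g^[1+yj] (^∈ isSubgroup gⁱ∈H x))
        (subst (T ∘ H) (sym (^-* g∈ y j)) (^∈ isSubgroup gʲ∈H y)))
      where
      g^xi≡g^[1+yj] : (g ^ᴳ i) ^ᴳ x ≡ g ^ᴳ (1 + y * j)
      g^xi≡g^[1+yj] = trans (sym (^-* g∈ x i)) (cong (g ^ᴳ_) (sym eq))

    ^∉ : ∀ i → 0 < i → i < p → ¬ T (H (g ^ᴳ i))
    ^∉ i@(suc _) _ i<p gⁱ∈H with coprime-Bézout (Coprime.sym (prime⇒coprime p-prime i<p))
    ... | Bézout.+- x y eq = g∉H (^∈-bézout i p x y gⁱ∈H gᵖ∈H eq)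
    ... | Bézout.-+ x y eq = g∉H (^∈-bézout p i y x gᵖ∈H gⁱ∈H eq)

    ^∈-mod : ∀ i {y} → Element y → T (H (g ^ᴳ i · y)) → T (H (g ^ᴳ (i % p) · y))
    ^∈-mod i {y} y∈ gⁱy∈H = subst (T ∘ H) (x⁻¹·[x·y]≡y (gⁱ∈ (q * p)) (·-closed (gⁱ∈ r) y∈))
      (·∈ (⁻¹∈ (subst (T ∘ H) (sym (^-* g∈ q p)) (^∈ isSubgroup gᵖ∈H q))) (subst (T ∘ H) split gⁱy∈H))
      where
      open ≡-Reasoning
      r = i % p
      q = i / p
      i≡qp+r : i ≡ q * p + r
      i≡qp+r = trans (m≡m%n+[m/n]*n i p) (ℕ.+-comm r (q * p))
      split : g ^ᴳ i · y ≡ g ^ᴳ (q * p) · (g ^ᴳ r · y)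
      split = begin
        g ^ᴳ i · y                    ≡⟨ cong (λ e → g ^ᴳ e · y) i≡qp+r ⟩
        g ^ᴳ (q * p + r) · y          ≡⟨ cong (_· y) (^-+ g∈ (q * p) r) ⟩
        (g ^ᴳ (q * p) · g ^ᴳ r) · y    ≡⟨ assoc (g ^ᴳ (q * p)) (g ^ᴳ r) y ⟩
        g ^ᴳ (q * p) · (g ^ᴳ r · y)    ∎

    Cosets : ℕ → Subsetᵇ
    Cosets zero    y = false
    Cosets (suc m) y = Cosets m y ∨ H (g ^ᴳ m · y)

    Cosets-intro : ∀ {m i y} → i < m → T (H (g ^ᴳ i · y)) → T (Cosets m y)
    Cosets-intro {suc m} {i} {y} i<1+m gⁱy∈H with i ℕ.≟ m
    ... | yes refl = from T-∨ (inj₂ gⁱy∈H)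
    ... | no  i≢m  = from T-∨ (inj₁ (Cosets-intro (ℕ.≤∧≢⇒< (ℕ.≤-pred i<1+m) i≢m) gⁱy∈H))

    Cosets-elim : ∀ {m y} → T (Cosets m y) → Σ ℕ λ i → i < m × T (H (g ^ᴳ i · y))
    Cosets-elim {suc m} {y} y∈C with to T-∨ y∈C
    ... | inj₁ y∈Cₘ = let (i , i<m , gⁱy∈H) = Cosets-elim y∈Cₘ in i , ℕ.m<n⇒m<1+n i<m , gⁱy∈H
    ... | inj₂ gᵐy∈H = m , ℕ.n<1+n m , gᵐy∈H

    Cosets-disjoint : ∀ {m y} → m < p → Element y → T (Cosets m y) → T (H (g ^ᴳ m · y)) → ⊥
    Cosets-disjoint {m} {y} m<p y∈ y∈C gᵐy∈H with i , i<m , gⁱy∈H ← Cosets-elim y∈C =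
      ^∉ (m ∸ i) (ℕ.m<n⇒0<n∸m i<m) (ℕ.≤-<-trans (ℕ.m∸n≤m m i) m<p)
        (subst (T ∘ H) ([y·x]·x⁻¹≡y (·-closed (gⁱ∈ i) y∈) (gⁱ∈ (m ∸ i)))
          (·∈ (subst (T ∘ H) gᵐy≡gᵐ⁻ⁱgⁱy gᵐy∈H) (⁻¹∈ gⁱy∈H)))
      where
      open ≡-Reasoning
      gᵐy≡gᵐ⁻ⁱgⁱy : g ^ᴳ m · y ≡ g ^ᴳ (m ∸ i) · (g ^ᴳ i · y)
      gᵐy≡gᵐ⁻ⁱgⁱy = begin
        g ^ᴳ m · y                      ≡⟨ cong (λ e → g ^ᴳ e · y) (ℕ.m∸n+n≡m (ℕ.<⇒≤ i<m)) ⟨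
        g ^ᴳ (m ∸ i + i) · y            ≡⟨ cong (_· y) (^-+ g∈ (m ∸ i) i) ⟩
        (g ^ᴳ (m ∸ i) · g ^ᴳ i) · y      ≡⟨ assoc (g ^ᴳ (m ∸ i)) (g ^ᴳ i) y ⟩
        g ^ᴳ (m ∸ i) · (g ^ᴳ i · y)      ∎

    count-Cosets : ∀ m → m ≤ p → count (Cosets m) ≡ m * count H
    count-Cosets zero    _     =
      cong length (filter-none (T? ∘ Cosets zero) (All.universal (λ _ → id) elements))
    count-Cosets (suc m) 1+m≤p = begin
      count (Cosets (suc m))                          ≡⟨ count-∨ (Cosets-disjoint 1+m≤p) ⟩
      count (Cosets m) + count (λ y → H (g ^ᴳ m · y)) ≡⟨ cong₂ _+_ (count-Cosets m (ℕ.<⇒≤ 1+m≤p))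
                                                                   (count-translateˡ H (gⁱ∈ m)) ⟩
      m * count H + count H                           ≡⟨ ℕ.+-comm (m * count H) (count H) ⟩
      suc m * count H                                 ∎
      where open ≡-Reasoning

    -- The conjunct isElement y is needed: gⁱ · y ∈ H does not force y into G, the
    -- operation being defined on the whole carrier.
    ⟨g⟩H : Subsetᵇ
    ⟨g⟩H y = isElement y ∧ Cosets p y

    ⟨g⟩H-intro : ∀ i {y} → Element y → T (H (g ^ᴳ i · y)) → T (⟨g⟩H y)
    ⟨g⟩H-intro i y∈ gⁱy∈H = from T-∧ (y∈ , Cosets-intro (m%n<n i p) (^∈-mod i y∈ gⁱy∈H))

    ⟨g⟩H-elim : ∀ {y} → T (⟨g⟩H y) → Element y × Σ ℕ λ i → T (H (g ^ᴳ i · y))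
    ⟨g⟩H-elim y∈K with y∈ , y∈C ← to T-∧ y∈K = y∈ , let (i , _ , gⁱy∈H) = Cosets-elim {p} y∈C in i , gⁱy∈H

    ⟨g⟩H-·∈ : ∀ {a b} → T (⟨g⟩H a) → T (⟨g⟩H b) → T (⟨g⟩H (a · b))
    ⟨g⟩H-·∈ {a} {b} a∈K b∈K with a∈ , i , gⁱa∈H ← ⟨g⟩H-elim a∈K | b∈ , j , gʲb∈H ← ⟨g⟩H-elim b∈K =
      ⟨g⟩H-intro (j + i) (·-closed a∈ b∈) (subst (T ∘ H) (sym split) (·∈ (conj∈ (gⁱ∈ j) gⁱa∈H) gʲb∈H))
      where
      open ≡-Reasoning
      split : g ^ᴳ (j + i) · (a · b) ≡ ((g ^ᴳ j · (g ^ᴳ i · a)) · (g ^ᴳ j) ⁻¹) · (g ^ᴳ j · b)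
      split = begin
        g ^ᴳ (j + i) · (a · b)                              ≡⟨ cong (_· (a · b)) (^-+ g∈ j i) ⟩
        (g ^ᴳ j · g ^ᴳ i) · (a · b)                          ≡⟨ assoc (g ^ᴳ j) (g ^ᴳ i) (a · b) ⟩
        g ^ᴳ j · (g ^ᴳ i · (a · b))                          ≡⟨ cong (g ^ᴳ j ·_) (assoc (g ^ᴳ i) a b) ⟨
        g ^ᴳ j · ((g ^ᴳ i · a) · b)                          ≡⟨ conjugate-split (g ^ᴳ i · a) (gⁱ∈ j) b∈ ⟩
        ((g ^ᴳ j · (g ^ᴳ i · a)) · (g ^ᴳ j) ⁻¹) · (g ^ᴳ j · b) ∎

    ⟨g⟩H-⁻¹∈ : ∀ {κ} → T (⟨g⟩H κ) → T (⟨g⟩H (κ ⁻¹))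
    ⟨g⟩H-⁻¹∈ {κ} κ∈K with κ∈ , i , gⁱκ∈H ← ⟨g⟩H-elim κ∈K =
      ⟨g⟩H-intro j (⁻¹-closed κ∈) (subst (T ∘ H) (sym split) (·∈ (conj∈ (gⁱ∈ j) (⁻¹∈ gⁱκ∈H)) gʲgⁱ∈H))
      where
      open ≡-Reasoning
      -- j is chosen so that gʲ · gⁱ = (gᵖ)ⁱ ∈ H
      j = i * ℕ.pred p
      j+i≡i*p : j + i ≡ i * p
      j+i≡i*p = begin
        i * ℕ.pred p + i     ≡⟨ ℕ.+-comm (i * ℕ.pred p) i ⟩
        i + i * ℕ.pred p     ≡⟨ ℕ.*-suc i (ℕ.pred p) ⟨
        i * suc (ℕ.pred p)   ≡⟨ cong (i *_) (ℕ.suc-pred p) ⟩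
        i * p                ∎
      gʲgⁱ∈H : T (H (g ^ᴳ j · g ^ᴳ i))
      gʲgⁱ∈H = subst (T ∘ H) (trans (sym (^-* g∈ i p)) (trans (cong (g ^ᴳ_) (sym j+i≡i*p)) (^-+ g∈ j i)))
        (^∈ isSubgroup gᵖ∈H i)
      κ⁻¹≡ : κ ⁻¹ ≡ (g ^ᴳ i · κ) ⁻¹ · g ^ᴳ i
      κ⁻¹≡ = sym (trans (cong (_· g ^ᴳ i) (⁻¹-anti-homo (gⁱ∈ i) κ∈)) ([y·x⁻¹]·x≡y (gⁱ∈ i) (⁻¹-closed κ∈)))
      split : g ^ᴳ j · κ ⁻¹ ≡ ((g ^ᴳ j · (g ^ᴳ i · κ) ⁻¹) · (g ^ᴳ j) ⁻¹) · (g ^ᴳ j · g ^ᴳ i)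
      split = trans (cong (g ^ᴳ j ·_) κ⁻¹≡) (conjugate-split ((g ^ᴳ i · κ) ⁻¹) (gⁱ∈ j) (gⁱ∈ i))

    ⟨g⟩H-subgroup : IsSubgroup ⟨g⟩H
    ⟨g⟩H-subgroup = record
      { ⊆G  = proj₁ ∘ to T-∧
      ; ε∈  = ⟨g⟩H-intro 0 ε-closed (subst (T ∘ H) (sym (identityˡ ε-closed)) ε∈)
      ; ·∈  = ⟨g⟩H-·∈
      ; ⁻¹∈ = ⟨g⟩H-⁻¹∈
      }

    count-⟨g⟩H : count ⟨g⟩H ≡ p * count H
    count-⟨g⟩H = trans (count-cong (λ _ → proj₂ ∘ to T-∧) (λ y∈ y∈C → from T-∧ (y∈ , y∈C)))
                       (count-Cosets p ℕ.≤-refl)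

    p*|H|∣|G| : p * count H ∣ length elements
    p*|H|∣|G| = subst (_∣ length elements) count-⟨g⟩H (Lagrange.lagrange ⟨g⟩H-subgroup)

-- The group SL₂(ℤ/nℤ) for n = k + 1

module SL₂ (k : ℕ) where

  open import Data.Integer using (_+_; _*_; _-_; -_)
  open import Data.Nat using (_%_; _/_)

  private
    r-[r+q*N]≡-q*N : ∀ r q N → r - (r + q * N) ≡ - q * N
    r-[r+q*N]≡-q*N = solve-∀
    y+[x-y]≡x : ∀ x y → y + (x - y) ≡ x
    y+[x-y]≡x = solve-∀
    -[x-y]≡y-x : ∀ x y → - (x - y) ≡ y - x
    -[x-y]≡y-x = solve-∀
    [N-x]-[-x]≡1*N : ∀ N x → (N - x) - - x ≡ 1ℤ * N
    [N-x]-[-x]≡1*N = solve-∀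
    [x-y]-1≡x-[y+1] : ∀ x y → (x - y) - 1ℤ ≡ x - (y + 1ℤ)
    [x-y]-1≡x-[y+1] = solve-∀

  n : ℕ
  n = suc k

  N : ℤ
  N = + n

  open Congruence N public

  %-≈ : ∀ x → + (x % n) ≈ + x
  %-≈ x = mod (ℤ∣.divides (- + (x / n)) (begin
    + (x % n) - + x                          ≡⟨ cong (λ y → + (x % n) - y) +x≡ ⟩
    + (x % n) - (+ (x % n) + + (x / n) * N)  ≡⟨ r-[r+q*N]≡-q*N (+ (x % n)) (+ (x / n)) N ⟩
    - + (x / n) * N                          ∎))
    where
    open ≡-Reasoning
    +x≡ : + x ≡ + (x % n) + + (x / n) * N
    +x≡ = trans (cong +_ (m≡m%n+[m/n]*n x n))
                (trans (ℤ.pos-+ (x % n) (x / n ℕ.* n)) (cong (λ z → + (x % n) + z) (ℤ.pos-* (x / n) n)))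

  private
    %-shift : ∀ a b m → + a - + b ≡ + m * N → a % n ≡ b % n
    %-shift a b m eq = trans (cong (_% n) a≡b+m*n) ([m+kn]%n≡m%n b m n)
      where
      a≡b+m*n : a ≡ b ℕ.+ m ℕ.* n
      a≡b+m*n = ℤ.+-injective (begin
        + a                  ≡⟨ y+[x-y]≡x (+ a) (+ b) ⟨
        + b + (+ a - + b)    ≡⟨ cong (λ z → + b + z) eq ⟩
        + b + + m * N        ≡⟨ cong (λ z → + b + z) (ℤ.pos-* m n) ⟨
        + b + + (m ℕ.* n)    ≡⟨ ℤ.pos-+ b (m ℕ.* n) ⟨
        + (b ℕ.+ m ℕ.* n)    ∎)
        where open ≡-Reasoning

  ≈⇒%≡ : ∀ {a b} → + a ≈ + b → a % n ≡ b % n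
  ≈⇒%≡ {a} {b} (mod (ℤ∣.divides (+ m) eq)) = %-shift a b m eq
  ≈⇒%≡ {a} {b} (mod (ℤ∣.divides -[1+ m ] eq)) = sym (%-shift b a (suc m)
    (trans (sym (-[x-y]≡y-x (+ a) (+ b))) (trans (cong -_ eq) (ℤ.neg-distribˡ-* -[1+ m ] N))))

  %≡⇒≈ : ∀ {a b} → a % n ≡ b % n → + a ≈ + b
  %≡⇒≈ {a} {b} eq = ≈-trans (≈-sym (%-≈ a)) (≈-trans (≡⇒≈ (cong +_ eq)) (%-≈ b))

  canonical-injective : ∀ {a b} → a < n → b < n → + a ≈ + b → a ≡ b
  canonical-injective a<n b<n a≈b = trans (sym (m<n⇒m%n≡m a<n)) (trans (≈⇒%≡ a≈b) (m<n⇒m%n≡m b<n))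

  addₙ-≈ : ∀ x y → + addₙ n x y ≈ + x + + y
  addₙ-≈ x y = ≈-trans (%-≈ (x ℕ.+ y)) (≡⇒≈ (ℤ.pos-+ x y))

  mulₙ-≈ : ∀ x y → + mulₙ n x y ≈ + x * + y
  mulₙ-≈ x y = ≈-trans (%-≈ (x ℕ.* y)) (≡⇒≈ (ℤ.pos-* x y))

  negₙ-≈ : ∀ {x} → x ≤ n → + negₙ n x ≈ - + x
  negₙ-≈ {x} x≤n = ≈-trans (%-≈ (n ℕ.∸ x))
    (≈-trans (≡⇒≈ +[n∸x]≡N-x) (mod (ℤ∣.divides 1ℤ ([N-x]-[-x]≡1*N N (+ x)))))
    where
    +[n∸x]≡N-x : + (n ℕ.∸ x) ≡ N - + x
    +[n∸x]≡N-x = trans (sym (ℤ.⊖-≥ x≤n)) (sym (ℤ.m-n≡m⊖n n x))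

  -- Matrix identities are proved by lifting to ℤ, computing there, and returning through
  -- canonical-≋⇒≡: canonical representatives that are congruent modulo n are equal.
  ⟦_⟧ : Mat → ℤMat
  ⟦ m ⟧ = ℤmat (+ a m) (+ b m) (+ c m) (+ d m)

  Canonical : Mat → Set
  Canonical m = a m < n × b m < n × c m < n × d m < n

  canonical-≋⇒≡ : ∀ {x y} → Canonical x → Canonical y → ⟦ x ⟧ ≋ ⟦ y ⟧ → x ≡ y
  canonical-≋⇒≡ {mat _ _ _ _} {mat _ _ _ _} (a< , b< , c< , d<) (a<′ , b<′ , c<′ , d<′) (≋mat a≈ b≈ c≈ d≈)
    rewrite canonical-injective a< a<′ a≈ | canonical-injective b< b<′ b≈
          | canonical-injective c< c<′ c≈ | canonical-injective d< d<′ d≈ = refl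

  ⟦matMul⟧ : ∀ x y → ⟦ matMul n x y ⟧ ≋ ⟦ x ⟧ ⊗ ⟦ y ⟧
  ⟦matMul⟧ (mat a b c d) (mat a′ b′ c′ d′) =
    ≋mat (entry a a′ b c′) (entry a b′ b d′) (entry c a′ d c′) (entry c b′ d d′)
    where
    entry : ∀ x y z w → + addₙ n (mulₙ n x y) (mulₙ n z w) ≈ + x * + y + + z * + w
    entry x y z w = ≈-trans (addₙ-≈ (mulₙ n x y) (mulₙ n z w)) (+-cong (mulₙ-≈ x y) (mulₙ-≈ z w))

  ⟦matOne⟧ : ⟦ matOne n ⟧ ≋ I
  ⟦matOne⟧ = ≋mat (%-≈ 1) ≈-refl ≈-refl (%-≈ 1)

  ⟦matInv⟧ : ∀ {x} → Canonical x → ⟦ matInv n x ⟧ ≋ adj ⟦ x ⟧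
  ⟦matInv⟧ (_ , b< , c< , _) = ≋mat ≈-refl (negₙ-≈ (ℕ.<⇒≤ b<)) (negₙ-≈ (ℕ.<⇒≤ c<)) ≈-refl

  canonical-matMul : ∀ x y → Canonical (matMul n x y)
  canonical-matMul (mat a b c d) (mat a′ b′ c′ d′) =
    entry a a′ b c′ , entry a b′ b d′ , entry c a′ d c′ , entry c b′ d d′
    where
    entry : ∀ x y z w → addₙ n (mulₙ n x y) (mulₙ n z w) < n
    entry x y z w = m%n<n (mulₙ n x y ℕ.+ mulₙ n z w) n

  canonical-matOne : Canonical (matOne n)
  canonical-matOne = m%n<n 1 n , z<s , z<s , m%n<n 1 n

  canonical-matInv : ∀ {x} → Canonical x → Canonical (matInv n x)
  canonical-matInv {mat _ b c _} (a< , _ , _ , d<) = d< , m%n<n (n ℕ.∸ b) n , m%n<n (n ℕ.∸ c) n , a<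

  private
    +[yz+1]≡ : ∀ y z → + (y ℕ.* z ℕ.+ 1) ≡ + y * + z + 1ℤ
    +[yz+1]≡ y z = trans (ℤ.pos-+ (y ℕ.* z) 1) (cong (_+ 1ℤ) (ℤ.pos-* y z))

    x-y≈1⇒x≈y+1 : ∀ {P Q} → P - Q ≈ 1ℤ → P ≈ Q + 1ℤ
    x-y≈1⇒x≈y+1 {P} {Q} (mod (ℤ∣.divides q eq)) = mod (ℤ∣.divides q (trans (sym ([x-y]-1≡x-[y+1] P Q)) eq))

    x≈y+1⇒x-y≈1 : ∀ {P Q} → P ≈ Q + 1ℤ → P - Q ≈ 1ℤ
    x≈y+1⇒x-y≈1 {P} {Q} (mod (ℤ∣.divides q eq)) = mod (ℤ∣.divides q (trans ([x-y]-1≡x-[y+1] P Q) eq))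

  InSL⇒canonical∧det≈1 : ∀ {m} → InSL n m → Canonical m × det ⟦ m ⟧ ≈ 1ℤ
  InSL⇒canonical∧det≈1 {mat x y z w} m∈SL with bounds , det≡ ← to T-∧ m∈SL
    with x<n , bounds ← to T-∧ bounds
    with y<n , bounds ← to T-∧ bounds
    with z<n , w<n ← to T-∧ bounds =
    (ℕ.<ᵇ⇒< x n x<n , ℕ.<ᵇ⇒< y n y<n , ℕ.<ᵇ⇒< z n z<n , ℕ.<ᵇ⇒< w n w<n) ,
    x≈y+1⇒x-y≈1 (≈-trans (≡⇒≈ (sym (ℤ.pos-* x w)))
      (≈-trans (%≡⇒≈ (ℕ.≡ᵇ⇒≡ _ _ det≡)) (≡⇒≈ (+[yz+1]≡ y z))))

  canonical∧det≈1⇒InSL : ∀ {m} → Canonical m → det ⟦ m ⟧ ≈ 1ℤ → InSL n m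
  canonical∧det≈1⇒InSL {mat x y z w} (x< , y< , z< , w<) det≈1 =
    from T-∧ (from T-∧ (ℕ.<⇒<ᵇ x< , from T-∧ (ℕ.<⇒<ᵇ y< , from T-∧ (ℕ.<⇒<ᵇ z< , ℕ.<⇒<ᵇ w<))) ,
              ℕ.≡⇒≡ᵇ _ _ (≈⇒%≡ (≈-trans (≡⇒≈ (ℤ.pos-* x w))
                (≈-trans (x-y≈1⇒x≈y+1 det≈1) (≡⇒≈ (sym (+[yz+1]≡ y z)))))))

  private
    mats₃ : ℕ → ℕ → ℕ → List Mat
    mats₃ x y z = map (mat x y z) (upTo n)

    mats₂ : ℕ → ℕ → List Mat
    mats₂ x y = concatMap (mats₃ x y) (upTo n)

    mats₁ : ℕ → List Mat
    mats₁ x = concatMap (mats₂ x) (upTo n)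

    mats₃-tagged : ∀ {P : Mat → Set} {x y z} → (∀ w → P (mat x y z w)) → All P (mats₃ x y z)
    mats₃-tagged P-row = All.map⁺ (All.universal P-row (upTo n))

    allMats-unique : Unique (allMats n)
    allMats-unique =
      concatMap-unique mats₁ a (Unique.upTo⁺ n) (λ x →
        concatMap-unique (mats₂ x) b (Unique.upTo⁺ n) (λ y →
          concatMap-unique (mats₃ x y) c (Unique.upTo⁺ n) (λ z → Unique.map⁺ (cong d) (Unique.upTo⁺ n))
            (λ z → mats₃-tagged (λ _ → refl)))
          (λ y → All-concatMap⁺ (λ z → mats₃-tagged (λ _ → refl)) (upTo n)))
        (λ x → All-concatMap⁺ (λ y → All-concatMap⁺ (λ z → mats₃-tagged (λ _ → refl)) (upTo n)) (upTo n))

    allMats-complete : ∀ {m} → Canonical m → m ∈ allMats n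
    allMats-complete {mat x y z w} (x< , y< , z< , w<) =
      ∈-concatMap⁺ mats₁ (lose (∈-upTo⁺ x<) (∈-concatMap⁺ (mats₂ x) (lose (∈-upTo⁺ y<)
        (∈-concatMap⁺ (mats₃ x y) (lose (∈-upTo⁺ z<) (∈-map⁺ (mat x y z) (∈-upTo⁺ w<)))))))

  infixl 7 _·_
  _·_ : Mat → Mat → Mat
  _·_ = matMul n

  InSL⇒canonical : ∀ {x} → InSL n x → Canonical x
  InSL⇒canonical {x} x∈SL = proj₁ (InSL⇒canonical∧det≈1 {x} x∈SL)

  InSL⇒det≈1 : ∀ {x} → InSL n x → det ⟦ x ⟧ ≈ 1ℤ
  InSL⇒det≈1 {x} x∈SL = proj₂ (InSL⇒canonical∧det≈1 {x} x∈SL)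

  private

    module ≋-Reasoning = SetoidReasoning ≋-setoid

  matMul-assoc : ∀ x y z → (x · y) · z ≡ x · (y · z)
  matMul-assoc x y z = canonical-≋⇒≡ (canonical-matMul (x · y) z) (canonical-matMul x (y · z)) (begin
    ⟦ (x · y) · z ⟧            ≈⟨ ⟦matMul⟧ (x · y) z ⟩
    ⟦ x · y ⟧ ⊗ ⟦ z ⟧          ≈⟨ ⊗-congʳ ⟦ z ⟧ (⟦matMul⟧ x y) ⟩
    (⟦ x ⟧ ⊗ ⟦ y ⟧) ⊗ ⟦ z ⟧    ≡⟨ ⊗-assoc ⟦ x ⟧ ⟦ y ⟧ ⟦ z ⟧ ⟩
    ⟦ x ⟧ ⊗ (⟦ y ⟧ ⊗ ⟦ z ⟧)    ≈⟨ ⊗-congˡ ⟦ x ⟧ (⟦matMul⟧ y z) ⟨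
    ⟦ x ⟧ ⊗ ⟦ y · z ⟧          ≈⟨ ⟦matMul⟧ x (y · z) ⟨
    ⟦ x · (y · z) ⟧            ∎)
    where open ≋-Reasoning

  matOne-identityˡ : ∀ {x} → InSL n x → matOne n · x ≡ x
  matOne-identityˡ {x} x∈SL = canonical-≋⇒≡ (canonical-matMul (matOne n) x) (InSL⇒canonical {x} x∈SL) (begin
    ⟦ matOne n · x ⟧           ≈⟨ ⟦matMul⟧ (matOne n) x ⟩
    ⟦ matOne n ⟧ ⊗ ⟦ x ⟧       ≈⟨ ⊗-congʳ ⟦ x ⟧ ⟦matOne⟧ ⟩
    I ⊗ ⟦ x ⟧                  ≡⟨ ⊗-identityˡ ⟦ x ⟧ ⟩
    ⟦ x ⟧                      ∎)
    where open ≋-Reasoning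

  matOne-identityʳ : ∀ {x} → InSL n x → x · matOne n ≡ x
  matOne-identityʳ {x} x∈SL = canonical-≋⇒≡ (canonical-matMul x (matOne n)) (InSL⇒canonical {x} x∈SL) (begin
    ⟦ x · matOne n ⟧           ≈⟨ ⟦matMul⟧ x (matOne n) ⟩
    ⟦ x ⟧ ⊗ ⟦ matOne n ⟧       ≈⟨ ⊗-congˡ ⟦ x ⟧ ⟦matOne⟧ ⟩
    ⟦ x ⟧ ⊗ I                  ≡⟨ ⊗-identityʳ ⟦ x ⟧ ⟩
    ⟦ x ⟧                      ∎)
    where open ≋-Reasoning

  matInv-inverseˡ : ∀ {x} → InSL n x → matInv n x · x ≡ matOne n
  matInv-inverseˡ {x} x∈SL = canonical-≋⇒≡ (canonical-matMul (matInv n x) x) canonical-matOne (begin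
    ⟦ matInv n x · x ⟧         ≈⟨ ⟦matMul⟧ (matInv n x) x ⟩
    ⟦ matInv n x ⟧ ⊗ ⟦ x ⟧     ≈⟨ ⊗-congʳ ⟦ x ⟧ (⟦matInv⟧ {x} (InSL⇒canonical {x} x∈SL)) ⟩
    adj ⟦ x ⟧ ⊗ ⟦ x ⟧          ≡⟨ adj-⊗ˡ ⟦ x ⟧ ⟩
    ℤmat (det ⟦ x ⟧) 0ℤ 0ℤ (det ⟦ x ⟧) ≈⟨ det≈1⇒≋I ⟦ x ⟧ (InSL⇒det≈1 {x} x∈SL) ⟩
    I                          ≈⟨ ⟦matOne⟧ ⟨
    ⟦ matOne n ⟧               ∎)
    where open ≋-Reasoning

  matInv-inverseʳ : ∀ {x} → InSL n x → x · matInv n x ≡ matOne n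
  matInv-inverseʳ {x} x∈SL = canonical-≋⇒≡ (canonical-matMul x (matInv n x)) canonical-matOne (begin
    ⟦ x · matInv n x ⟧         ≈⟨ ⟦matMul⟧ x (matInv n x) ⟩
    ⟦ x ⟧ ⊗ ⟦ matInv n x ⟧     ≈⟨ ⊗-congˡ ⟦ x ⟧ (⟦matInv⟧ {x} (InSL⇒canonical {x} x∈SL)) ⟩
    ⟦ x ⟧ ⊗ adj ⟦ x ⟧          ≡⟨ ⊗-adjʳ ⟦ x ⟧ ⟩
    ℤmat (det ⟦ x ⟧) 0ℤ 0ℤ (det ⟦ x ⟧) ≈⟨ det≈1⇒≋I ⟦ x ⟧ (InSL⇒det≈1 {x} x∈SL) ⟩
    I                          ≈⟨ ⟦matOne⟧ ⟨
    ⟦ matOne n ⟧               ∎)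
    where open ≋-Reasoning

  matMul-closed : ∀ {x y} → InSL n x → InSL n y → InSL n (x · y)
  matMul-closed {x} {y} x∈SL y∈SL = canonical∧det≈1⇒InSL {x · y} (canonical-matMul x y)
    (≈-trans (det-cong (⟦matMul⟧ x y))
      (≈-trans (≡⇒≈ (det-⊗ ⟦ x ⟧ ⟦ y ⟧)) (*-cong (InSL⇒det≈1 {x} x∈SL) (InSL⇒det≈1 {y} y∈SL))))

  matOne-closed : InSL n (matOne n)
  matOne-closed = canonical∧det≈1⇒InSL {matOne n} canonical-matOne (det-cong ⟦matOne⟧)

  matInv-closed : ∀ {x} → InSL n x → InSL n (matInv n x)
  matInv-closed {x} x∈SL = canonical∧det≈1⇒InSL {matInv n x} (canonical-matInv {x} (InSL⇒canonical {x} x∈SL))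
    (≈-trans (det-cong (⟦matInv⟧ {x} (InSL⇒canonical {x} x∈SL)))
      (≈-trans (≡⇒≈ (det-adj ⟦ x ⟧)) (InSL⇒det≈1 {x} x∈SL)))

  SL₂-group : FiniteGroup
  SL₂-group = record
    { Carrier           = Mat
    ; isElement         = inSLᵇ n
    ; elements          = SLElems n
    ; elements-unique   = Unique.filter⁺ (T? ∘ inSLᵇ n) allMats-unique
    ; elements-complete = λ {x} x∈SL →
                            ∈-filter⁺ (T? ∘ inSLᵇ n) (allMats-complete (InSL⇒canonical {x} x∈SL)) x∈SL
    ; elements-sound    = λ x∈ → proj₂ (∈-filter⁻ (T? ∘ inSLᵇ n) {xs = allMats n} x∈)
    ; _·_       = matMul n
    ; ε         = matOne n
    ; _⁻¹       = matInv n
    ; ·-closed  = λ {x} {y} → matMul-closed {x} {y}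
    ; ε-closed  = matOne-closed
    ; ⁻¹-closed = λ {x} → matInv-closed {x}
    ; assoc     = matMul-assoc
    ; identityˡ = λ {x} → matOne-identityˡ {x}
    ; identityʳ = λ {x} → matOne-identityʳ {x}
    ; inverseˡ  = λ {x} → matInv-inverseˡ {x}
    ; inverseʳ  = λ {x} → matInv-inverseʳ {x}
    }

  open FiniteGroupTheory SL₂-group public

  IsNormalSubgroup⇒IsNormal : ∀ {H} → IsNormalSubgroup n H → IsNormal H
  IsNormalSubgroup⇒IsNormal H-normal = record
    { isSubgroup = record
      { ⊆G  = λ {x} → ⊆SL x
      ; ε∈  = one∈
      ; ·∈  = λ {x} {y} → mul∈ x y
      ; ⁻¹∈ = λ {x} → inv∈ x
      }
    ; conj∈ = λ {g} {h} → normal g h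
    }
    where open IsNormalSubgroup H-normal

  upper lower : ℕ → Mat
  upper t = mat (1 % n) (t % n) 0 (1 % n)
  lower t = mat (1 % n) 0 (t % n) (1 % n)

  private
    1*1-x*0≡1 : ∀ x → 1ℤ * 1ℤ - x * 0ℤ ≡ 1ℤ
    1*1-x*0≡1 = solve-∀
    1*1-0*x≡1 : ∀ x → 1ℤ * 1ℤ - 0ℤ * x ≡ 1ℤ
    1*1-0*x≡1 = solve-∀
    1y+x1≡x+y : ∀ x y → 1ℤ * y + x * 1ℤ ≡ x + y
    1y+x1≡x+y = solve-∀
    x1+1y≡x+y : ∀ x y → x * 1ℤ + 1ℤ * y ≡ x + y
    x1+1y≡x+y = solve-∀

  ⟦upper⟧ : ∀ t → ⟦ upper t ⟧ ≋ ℤmat 1ℤ (+ t) 0ℤ 1ℤ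
  ⟦upper⟧ t = ≋mat (%-≈ 1) (%-≈ t) ≈-refl (%-≈ 1)

  ⟦lower⟧ : ∀ t → ⟦ lower t ⟧ ≋ ℤmat 1ℤ 0ℤ (+ t) 1ℤ
  ⟦lower⟧ t = ≋mat (%-≈ 1) ≈-refl (%-≈ t) (%-≈ 1)

  canonical-upper : ∀ t → Canonical (upper t)
  canonical-upper t = m%n<n 1 n , m%n<n t n , z<s , m%n<n 1 n

  canonical-lower : ∀ t → Canonical (lower t)
  canonical-lower t = m%n<n 1 n , z<s , m%n<n t n , m%n<n 1 n

  upper-∈ : ∀ t → InSL n (upper t)
  upper-∈ t = canonical∧det≈1⇒InSL {upper t} (canonical-upper t)
    (≈-trans (det-cong (⟦upper⟧ t)) (≡⇒≈ (1*1-x*0≡1 (+ t))))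

  lower-∈ : ∀ t → InSL n (lower t)
  lower-∈ t = canonical∧det≈1⇒InSL {lower t} (canonical-lower t)
    (≈-trans (det-cong (⟦lower⟧ t)) (≡⇒≈ (1*1-0*x≡1 (+ t))))

  upper-+ : ∀ x y → upper x · upper y ≡ upper (x ℕ.+ y)
  upper-+ x y = canonical-≋⇒≡ (canonical-matMul (upper x) (upper y)) (canonical-upper (x ℕ.+ y)) (begin
    ⟦ upper x · upper y ⟧                               ≈⟨ ⟦matMul⟧ (upper x) (upper y) ⟩
    ⟦ upper x ⟧ ⊗ ⟦ upper y ⟧                           ≈⟨ ⊗-cong (⟦upper⟧ x) (⟦upper⟧ y) ⟩
    ℤmat 1ℤ (+ x) 0ℤ 1ℤ ⊗ ℤmat 1ℤ (+ y) 0ℤ 1ℤ          ≡⟨ ℤmat-≡ (x1+y0≡x 1ℤ (+ x)) (1y+x1≡x+y (+ x) (+ y))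
                                                                 refl (0x+1y≡y (+ y) 1ℤ) ⟩
    ℤmat 1ℤ (+ x + + y) 0ℤ 1ℤ                           ≡⟨ cong (λ z → ℤmat 1ℤ z 0ℤ 1ℤ) (ℤ.pos-+ x y) ⟨
    ℤmat 1ℤ (+ (x ℕ.+ y)) 0ℤ 1ℤ                          ≈⟨ ⟦upper⟧ (x ℕ.+ y) ⟨
    ⟦ upper (x ℕ.+ y) ⟧                                 ∎)
    where open ≋-Reasoning

  lower-+ : ∀ x y → lower x · lower y ≡ lower (x ℕ.+ y)
  lower-+ x y = canonical-≋⇒≡ (canonical-matMul (lower x) (lower y)) (canonical-lower (x ℕ.+ y)) (begin
    ⟦ lower x · lower y ⟧                               ≈⟨ ⟦matMul⟧ (lower x) (lower y) ⟩
    ⟦ lower x ⟧ ⊗ ⟦ lower y ⟧                           ≈⟨ ⊗-cong (⟦lower⟧ x) (⟦lower⟧ y) ⟩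
    ℤmat 1ℤ 0ℤ (+ x) 1ℤ ⊗ ℤmat 1ℤ 0ℤ (+ y) 1ℤ          ≡⟨ ℤmat-≡ (1x+0y≡x 1ℤ (+ y)) refl
                                                                 (x1+1y≡x+y (+ x) (+ y)) (x0+y1≡y (+ x) 1ℤ) ⟩
    ℤmat 1ℤ 0ℤ (+ x + + y) 1ℤ                           ≡⟨ cong (λ z → ℤmat 1ℤ 0ℤ z 1ℤ) (ℤ.pos-+ x y) ⟨
    ℤmat 1ℤ 0ℤ (+ (x ℕ.+ y)) 1ℤ                          ≈⟨ ⟦lower⟧ (x ℕ.+ y) ⟨
    ⟦ lower (x ℕ.+ y) ⟧                                 ∎)
    where open ≋-Reasoning

  upper-^ : ∀ t i → upper t ^ᴳ i ≡ upper (i ℕ.* t)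
  upper-^ t zero    = refl
  upper-^ t (suc i) = trans (cong (upper t ·_) (upper-^ t i)) (upper-+ t (i ℕ.* t))

  lower-^ : ∀ t i → lower t ^ᴳ i ≡ lower (i ℕ.* t)
  lower-^ t zero    = refl
  lower-^ t (suc i) = trans (cong (lower t ·_) (lower-^ t i)) (lower-+ t (i ℕ.* t))

  data Elementary : Mat → Set where
    upper-elementary : ∀ t → Elementary (upper t)
    lower-elementary : ∀ t → Elementary (lower t)

  elementary-∈ : ∀ {e} → Elementary e → InSL n e
  elementary-∈ (upper-elementary t) = upper-∈ t
  elementary-∈ (lower-elementary t) = lower-∈ t

  private
    n*t%n≡0 : ∀ t → (n ℕ.* t) % n ≡ 0
    n*t%n≡0 t = trans (cong (_% n) (ℕ.*-comm n t)) (m*n%n≡0 t n)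

  elementary-^n : ∀ {e} → Elementary e → e ^ᴳ n ≡ matOne n
  elementary-^n (upper-elementary t) = trans (upper-^ t n) (cong (λ z → mat (1 % n) z 0 (1 % n)) (n*t%n≡0 t))
  elementary-^n (lower-elementary t) = trans (lower-^ t n) (cong (λ z → mat (1 % n) 0 z (1 % n)) (n*t%n≡0 t))

  lower-n : lower n ≡ matOne n
  lower-n = cong (λ z → mat (1 % n) 0 z (1 % n)) (n%n≡0 n)

  private
    x-[-1]≡1+x : ∀ x → x - - 1ℤ ≡ 1ℤ + x
    x-[-1]≡1+x = solve-∀
    1+x-1≡x : ∀ x → 1ℤ + x - 1ℤ ≡ x
    1+x-1≡x = solve-∀
    x-[x-y]≡y : ∀ x y → x - (x - y) ≡ y
    x-[x-y]≡y = solve-∀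

  k≈-1 : + k ≈ - 1ℤ
  k≈-1 = mod (ℤ∣.divides 1ℤ
    (trans (x-[-1]≡1+x (+ k)) (trans (sym (ℤ.pos-+ 1 k)) (sym (ℤ.*-identityˡ N)))))

  module PrimePowerModulus {p s} (p-prime : Prime p) (s>0 : s ℕ.> 0) (pˢ≡n : p ^ s ≡ n) where

    Invertible : ℕ → Set
    Invertible u = Σ ℕ λ e → + u * + e ≈ 1ℤ

    private
      p∣n : p ∣ n
      p∣n = subst (p ∣_) pˢ≡n (p∣pˢ s s>0)
        where
        p∣pˢ : ∀ s → s ℕ.> 0 → p ∣ p ^ s
        p∣pˢ (suc s′) _ = ℕ∣.m∣m*n (p ^ s′)

    ∣-resp-≈ : ∀ {x y} → + p ℤ∣.∣ x → x ≈ y → + p ℤ∣.∣ y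
    ∣-resp-≈ {x} {y} p∣x (mod N∣x-y) =
      subst (+ p ℤ∣.∣_) (x-[x-y]≡y x y) (ℤ∣.∣m∣n⇒∣m-n p∣x (ℤ∣.∣-trans (ℤ∣.∣ᵤ⇒∣ p∣n) N∣x-y))

    invertible-or-divisible : ∀ u → p ∣ u ⊎ Invertible u
    invertible-or-divisible u with p ℕ∣.∣? u
    ... | yes p∣u = inj₁ p∣u
    ... | no  p∤u with coprime-Bézout (subst (Coprime u) pˢ≡n (coprime-^ (prime∤⇒coprime p-prime p∤u) s))
    ...   | Bézout.+- x y 1+yn≡xu = inj₂ (x , mod (ℤ∣.divides (+ y) (begin
      + u * + x - 1ℤ          ≡⟨ cong (_- 1ℤ) (trans (ℤ.*-comm (+ u) (+ x)) (sym (ℤ.pos-* x u))) ⟩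
      + (x ℕ.* u) - 1ℤ        ≡⟨ cong (λ z → + z - 1ℤ) 1+yn≡xu ⟨
      + (1 ℕ.+ y ℕ.* n) - 1ℤ  ≡⟨ cong (_- 1ℤ) (trans (ℤ.pos-+ 1 (y ℕ.* n))
                                                    (cong (λ z → 1ℤ + z) (ℤ.pos-* y n))) ⟩
      1ℤ + + y * N - 1ℤ       ≡⟨ 1+x-1≡x (+ y * N) ⟩
      + y * N                 ∎)))
      where open ≡-Reasoning
    ...   | Bézout.-+ x y 1+xu≡yn = inj₂ (x ℕ.* k , ≈-trans (≡⇒≈ reassociate) (*-cong ux≈-1 k≈-1))
      where
      open ≡-Reasoning
      reassociate : + u * + (x ℕ.* k) ≡ + u * + x * + k
      reassociate = trans (cong (+ u *_) (ℤ.pos-* x k)) (sym (ℤ.*-assoc (+ u) (+ x) (+ k)))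
      ux≈-1 : + u * + x ≈ - 1ℤ
      ux≈-1 = mod (ℤ∣.divides (+ y) (begin
        + u * + x - - 1ℤ      ≡⟨ x-[-1]≡1+x (+ u * + x) ⟩
        1ℤ + + u * + x        ≡⟨ cong (λ z → 1ℤ + z) (trans (ℤ.*-comm (+ u) (+ x)) (sym (ℤ.pos-* x u))) ⟩
        1ℤ + + (x ℕ.* u)      ≡⟨ ℤ.pos-+ 1 (x ℕ.* u) ⟨
        + (1 ℕ.+ x ℕ.* u)     ≡⟨ cong +_ 1+xu≡yn ⟩
        + (y ℕ.* n)           ≡⟨ ℤ.pos-* y n ⟩
        + y * N               ∎))

    ¬both-divisible : ∀ {g} → InSL n g → p ∣ a g → p ∣ c g → ⊥
    ¬both-divisible {g} g∈ p∣a p∣c = ℕ.nonTrivial⇒≢1 {{prime⇒nonTrivial p-prime}}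
      (ℕ∣.∣1⇒≡1 (ℤ∣.∣⇒∣ᵤ (∣-resp-≈ p∣det (InSL⇒det≈1 {g} g∈))))
      where
      p∣det : + p ℤ∣.∣ det ⟦ g ⟧
      p∣det = ℤ∣.∣m∣n⇒∣m-n (ℤ∣.∣m⇒∣m*n (+ d g) (ℤ∣.∣ᵤ⇒∣ {+ p} {+ a g} p∣a))
                          (ℤ∣.∣n⇒∣m*n (+ b g) (ℤ∣.∣ᵤ⇒∣ {+ p} {+ c g} p∣c))

    -- Since k ≡ -1, the exponents (a + k)·e and (d + k)·e represent (a - 1)c⁻¹ and (d - 1)c⁻¹.
    upper-lower-upper : ∀ {g e} → InSL n g → + c g * + e ≈ 1ℤ →
      upper ((a g ℕ.+ k) ℕ.* e) · (lower (c g) · upper ((d g ℕ.+ k) ℕ.* e)) ≡ g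
    upper-lower-upper {g} {e} g∈ ce≈1 =
      canonical-≋⇒≡ (canonical-matMul (upper x) (lower (c g) · upper y)) (InSL⇒canonical {g} g∈) (begin
      ⟦ upper x · (lower (c g) · upper y) ⟧          ≈⟨ ⟦matMul⟧ (upper x) (lower (c g) · upper y) ⟩
      ⟦ upper x ⟧ ⊗ ⟦ lower (c g) · upper y ⟧        ≈⟨ ⊗-cong (shifted-upper (a g))
                                                          (≋-trans (⟦matMul⟧ (lower (c g)) (upper y))
                                                                   (⊗-cong (⟦lower⟧ (c g)) (shifted-upper (d g)))) ⟩
      ℤmat 1ℤ ((+ a g - 1ℤ) * + e) 0ℤ 1ℤ ⊗ (ℤmat 1ℤ 0ℤ (+ c g) 1ℤ ⊗ ℤmat 1ℤ ((+ d g - 1ℤ) * + e) 0ℤ 1ℤ)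
                                                     ≈⟨ upper-lower-upper-ℤ ce≈1 (InSL⇒det≈1 {g} g∈) ⟩
      ⟦ g ⟧                                          ∎)
      where
      open ≋-Reasoning
      x = (a g ℕ.+ k) ℕ.* e
      y = (d g ℕ.+ k) ℕ.* e
      shifted-upper : ∀ v → ⟦ upper ((v ℕ.+ k) ℕ.* e) ⟧ ≋ ℤmat 1ℤ ((+ v - 1ℤ) * + e) 0ℤ 1ℤ
      shifted-upper v = ≋-trans (⟦upper⟧ _) (≋mat ≈-refl
        (≈-trans (≡⇒≈ (trans (ℤ.pos-* (v ℕ.+ k) e) (cong (_* + e) (ℤ.pos-+ v k))))
                 (*-congʳ (+ e) (+-congˡ (+ v) k≈-1)))
        ≈-refl ≈-refl)

    Factorisation : Mat → Set
    Factorisation g = Σ (List Mat) λ es → All Elementary es × product es ≡ g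

    unit-corner-factorisation : ∀ {g} → InSL n g → Invertible (c g) → Factorisation g
    unit-corner-factorisation {g} g∈ (e , ce≈1) =
      upper x ∷ lower (c g) ∷ upper y ∷ [] ,
      upper-elementary x ∷ lower-elementary (c g) ∷ upper-elementary y ∷ [] ,
      trans (cong (λ z → upper x · (lower (c g) · z)) (matOne-identityʳ {upper y} (upper-∈ y)))
            (upper-lower-upper g∈ ce≈1)
      where
      x = (a g ℕ.+ k) ℕ.* e
      y = (d g ℕ.+ k) ℕ.* e

    lower-prepend : ∀ {g} → InSL n g → Factorisation (lower 1 · g) → Factorisation g
    lower-prepend {g} g∈ (es , es-elementary , ∏es≡g′) =
      lower k ∷ es , lower-elementary k ∷ es-elementary , (begin
        lower k · product es       ≡⟨ cong (lower k ·_) ∏es≡g′ ⟩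
        lower k · (lower 1 · g)    ≡⟨ matMul-assoc (lower k) (lower 1) g ⟨
        (lower k · lower 1) · g    ≡⟨ cong (_· g) lower-k·lower-1≡1 ⟩
        matOne n · g               ≡⟨ matOne-identityˡ {g} g∈ ⟩
        g                          ∎)
      where
      open ≡-Reasoning
      lower-k·lower-1≡1 : lower k · lower 1 ≡ matOne n
      lower-k·lower-1≡1 = trans (lower-+ k 1) (trans (cong lower (ℕ.+-comm k 1)) lower-n)

    elementary-factorisation : ∀ {g} → InSL n g → Factorisation g
    elementary-factorisation {g} g∈ with invertible-or-divisible (c g)
    ... | inj₂ c-invertible = unit-corner-factorisation g∈ c-invertible
    ... | inj₁ p∣c = lower-prepend g∈ (unit-corner-factorisation g′∈ c′-invertible)
      where
      g′ = lower 1 · g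
      g′∈ : InSL n g′
      g′∈ = matMul-closed {lower 1} {g} (lower-∈ 1) g∈
      c′≈a+c : + c g′ ≈ + a g + + c g
      c′≈a+c = ≈-trans (C≈ (≋-trans (⟦matMul⟧ (lower 1) g) (⊗-congʳ ⟦ g ⟧ (⟦lower⟧ 1))))
                       (≡⇒≈ (cong₂ _+_ (ℤ.*-identityˡ (+ a g)) (ℤ.*-identityˡ (+ c g))))
      c′-invertible : Invertible (c g′)
      c′-invertible with invertible-or-divisible (c g′)
      ... | inj₂ c′-invertible = c′-invertible
      ... | inj₁ p∣c′ = ⊥-elim (¬both-divisible {g} g∈ p∣a p∣c)
        where
        p∣a : p ∣ a g
        p∣a = ℤ∣.∣⇒∣ᵤ {+ p} {+ a g} (ℤ∣.∣m+n∣n⇒∣m (∣-resp-≈ (ℤ∣.∣ᵤ⇒∣ {+ p} {+ c g′} p∣c′) c′≈a+c)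
                                                  (ℤ∣.∣ᵤ⇒∣ {+ p} {+ c g} p∣c))

    elementary-∉ : ∀ {H} → IsSubgroup H → ∀ {g} → InSL n g → ¬ T (H g) → Σ Mat λ u → Elementary u × ¬ T (H u)
    elementary-∉ {H} H-subgroup g∈SL g∉H
      with es , es-elementary , ∏es≡g ← elementary-factorisation g∈SL
      with u , u∈es , u∉H ← product-∉ H-subgroup (g∉H ∘ subst (T ∘ H) ∏es≡g)
      = u , All.lookup es-elementary u∈es , u∉H

    elementary-^pˢ∈ : ∀ {H} → IsSubgroup H → ∀ {u} → Elementary u → T (H (u ^ᴳ (p ^ s)))
    elementary-^pˢ∈ {H} H-subgroup {u} u-elementary =
      subst (T ∘ H) (sym (trans (cong (u ^ᴳ_) pˢ≡n) (elementary-^n u-elementary))) (IsSubgroup.ε∈ H-subgroup)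

    p*|H|∣|SL₂| : ∀ {H} → IsNormal H → ∀ {g} → InSL n g → ¬ T (H g) → p ℕ.* count H ∣ length (SLElems n)
    p*|H|∣|SL₂| {H} H-normal g∈SL g∉H
      with u , u-elementary , u∉H ← elementary-∉ (IsNormal.isSubgroup H-normal) g∈SL g∉H
      with j , v∉H , vᵖ∈H ← prime-power-escape {H} (elementary-∈ u-elementary) p s u∉H
                                (elementary-^pˢ∈ {H} (IsNormal.isSubgroup H-normal) u-elementary)
      = PrimeExtension.p*|H|∣|G| H-normal (^-closed (elementary-∈ u-elementary) (p ^ j)) p-prime v∉H vᵖ∈H

proposition5p3 : (p s : ℕ) → Prime p → s > 0 → (H : Subset (p ^ s)) → IsNormalSubgroup (p ^ s) H → Proper (p ^ s) H → p ∣ index (p ^ s) H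
proposition5p3 p s p-prime s>0 H H-normal (g , g∈SL , Hg≡false) with p ^ s in pˢ≡n
... | zero  = ⊥-elim (NonZero.nonZero (subst NonZero pˢ≡n (ℕ.m^n≢0 p s {{prime⇒nonZero p-prime}})))
... | suc k = p*h∣o⇒p∣o/h (count-pos matOne-closed (IsNormalSubgroup.one∈ H-normal))
                (p*|H|∣|SL₂| (IsNormalSubgroup⇒IsNormal H-normal) g∈SL (subst T Hg≡false))
  where
  open SL₂ k
  open PrimePowerModulus p-prime s>0 pˢ≡n
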